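{- Let $r\ge1$ be an integer, and let $\chi(x)=1$ if $x$ is an integer and $\chi(x)=0$ otherwise. Then $H_1^{(r)}=1$ if $r\le 2$ and $H_1^{(r)}=0$ otherwise; $H_2^{(r)}=1$; $$2H_3^{(r)}=3+r-(-1)^{r/2}\chi(r/2),\qquad 6H_4^{(r)}=8+9r+r^2-2\chi(r/3),$$ $$24H_5^{(r)}=42+59r+18r^2+r^3-(18+3r)(-1)^{r/2}\chi(r/2),$$ $$120H_6^{(r)}=264+450r+215r^2+30r^3+r^4-24\chi(r/5).$$ In general, for every integer $j\ge1$, $$H_{j+1}^{(r)}=\sum_{d\mid j,\ 2\nmid d}\mu(d)\chi\!\left(\tfrac rd\right)\frac{A(j/d,r/d)}{r\,(j/d)!}+\sum_{d\mid j,\ 2\mid d}\mu(d)(-1)^{r/2}\chi\!\left(\tfrac rd\right)\frac{A(j/d,r/d)}{r\,(j/d)!}.$$ Finally, for fixed $j\ge 3$, as $r\to\infty$, $$H_{j+1}^{(r)}=\frac{r^{j-1}}{j!}+\frac{3r^{j-2}}{2(j-2)!}+O_j(r^{j-2}).$$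
   Context: For a positive integer $r$, the convolved Fibonacci numbers $F_{j+1}^{(r)}$ ($j\ge0$) are defined by $(1-z-z^2)^{ -r}=\sum_{j\ge 0}F_{j+1}^{(r)}z^j$. For $j\ge1$, $A(j,r)\in\mathbb{Z}[r]$ denotes the polynomial in $r$ with $F_{j+1}^{(r)}=A(j,r)/j!$ for all integers $r\ge1$ (it is monic of degree $j$ with zero constant term). The sign twisted convoluted convolved Fibonacci numbers are $H_{j+1}^{(r)}=\frac{(-1)^r}{r}\sum_{d\mid\gcd(r,j)}\mu(d)(-1)^{r/d}F_{j/d+1}^{(r/d)}$ ($\mu$ the Möbius function; for $j=0$, $d$ ranges over divisors of $r$). In the general formula, a term whose factor $\chi(r/d)$ equals $0$ is interpreted as $0$ (even if $(-1)^{r/2}$ is undefined). -}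

module Defs where

open import Data.Bool using (Bool; true; false; if_then_else_; _∨_; _∧_)
open import Data.Nat as ℕ using (ℕ; zero; suc; _+_; _*_; _∸_; _^_; _/_; NonZero; _!)
open import Data.Nat.Properties using (m*n≢0; _!≢0)
open import Data.Nat.Divisibility using (_∣?_)
open import Data.Nat.Primality using (prime?)
open import Data.Nat.GCD using (gcd)
open import Data.Nat.Base using (_≤ᵇ_)
open import Data.List using (List; upTo; map; filter; length; foldr)
open import Data.Nat.ListAction using (sum)
open import Data.Bool.ListAction using (any)
open import Data.Integer as ℤ using (ℤ; +_)
open import Data.Rational as ℚ using (ℚ)
open import Relation.Nullary using (does)

Series : Set
Series = ℕ → ℕ

_·_ : Series → Series → Series
(f · g) n = sum (map (λ k → f k * g (n ∸ k)) (upTo (suc n)))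

one : Series
one zero    = 1
one (suc _) = 0

-- fibInv is the power series (1 - z - z²)⁻¹: its coefficients are the
-- unique solution of (1 - z - z²)·G = 1, i.e. g₀ = 1, g₁ = 1,
-- g_{n+2} = g_{n+1} + g_n.
fibInv : Series
fibInv zero          = 1
fibInv (suc zero)    = 1
fibInv (suc (suc n)) = fibInv (suc n) + fibInv n

fibInvPow : ℕ → Series
fibInvPow zero    = one
fibInvPow (suc r) = fibInv · fibInvPow r

-- Convolved Fibonacci numbers: F r j = F_{j+1}^{(r)} = [z^j] (1 - z - z²)^{-r}
F : ℕ → ℕ → ℕ
F r j = fibInvPow r j

-- A(j,r) evaluated at a positive integer r: the value of the polynomial
-- A(j,·) ∈ ℤ[r] at r, i.e. A(j,r) = j! · F_{j+1}^{(r)}  (r ≥ 1).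
A : ℕ → ℕ → ℤ
A j r = + (j ! * F r j)

negOnePow : ℕ → ℤ
negOnePow zero    = + 1
negOnePow (suc n) = ℤ.- negOnePow n

squarefree : ℕ → Bool
squarefree n = Data.Bool.not (any (λ k → (2 ≤ᵇ k) ∧ does ((k * k) ∣? n)) (upTo (suc n)))
  where import Data.Bool

μ : ℕ → ℤ
μ n = if squarefree n
      then negOnePow (length (filter (λ p → prime? p) (filter (λ d → d ∣? n) (upTo (suc n)))))
      else + 0

-- Sum over the divisors d ≥ 1 of n (d = suc k, so that NonZero d is an instance).

sumDiv : ℕ → ((d : ℕ) → .{{NonZero d}} → ℚ) → ℚ
sumDiv n f = foldr ℚ._+_ ℚ.0ℚ (map (λ k → f (suc k)) (filter (λ k → suc k ∣? n) (upTo n)))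

sumDivℤ : ℕ → ((d : ℕ) → .{{NonZero d}} → ℤ) → ℤ
sumDivℤ n f = foldr ℤ._+_ (+ 0) (map (λ k → f (suc k)) (filter (λ k → suc k ∣? n) (upTo n)))

-- Sign twisted convoluted convolved Fibonacci numbers:
-- H r j = H_{j+1}^{(r)} = ((-1)^r / r) Σ_{d ∣ gcd(r,j)} μ(d) (-1)^{r/d} F_{j/d+1}^{(r/d)}
-- (for j = 0, gcd(r,0) = r so d ranges over the divisors of r).

H : (r : ℕ) → .{{NonZero r}} → ℕ → ℚ
H r j = (negOnePow r ℤ.* sumDivℤ (gcd r j) (λ d → μ d ℤ.* negOnePow (r / d) ℤ.* + F (r / d) (j / d))) ℚ./ r

-- χ(r/d) : 1 if d ∣ r, 0 otherwise.
χ : ℕ → ℕ → ℤ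
χ r d = if does (d ∣? r) then + 1 else + 0

-- (-1)^{r/2} χ(r/2), interpreted as 0 when r is odd.
sgnχ2 : ℕ → ℤ
sgnχ2 r = if does (2 ∣? r) then negOnePow (r / 2) else + 0

generalTerm : (r : ℕ) → .{{NonZero r}} → ℕ → (d : ℕ) → .{{NonZero d}} → ℚ
generalTerm r {{r≢0}} j d =
  if does (d ∣? r)
  then ((sgn ℤ.* μ d ℤ.* A (j / d) (r / d)) ℚ./ (r * (j / d) !)) {{m*n≢0 r ((j / d) !) {{r≢0}} {{(j / d) !≢0}}}}
  else ℚ.0ℚ
  where
  sgn : ℤ
  sgn = if does (2 ∣? d) then negOnePow (r / 2) else + 1

sumDivOdd sumDivEven : ℕ → ((d : ℕ) → .{{NonZero d}} → ℚ) → ℚ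
sumDivOdd n f = sumDiv n (λ d → if does (2 ∣? d) then ℚ.0ℚ else f d)
sumDivEven n f = sumDiv n (λ d → if does (2 ∣? d) then f d else ℚ.0ℚ)

generalRHS : (r : ℕ) → .{{NonZero r}} → ℕ → ℚ
generalRHS r j = sumDivOdd j (λ d → generalTerm r j d) ℚ.+ sumDivEven j (λ d → generalTerm r j d)

module Submission where

-- Since r·H r j = (-1)^r Σ_{d ∣ gcd(r,j)} μ(d) (-1)^(r/d) F(r/d, j/d), and (-1)^(r + r/d) equals 1
-- for odd d ∣ r and (-1)^(r/2) for d ∣ r with d ≡ 2 mod 4 (the remaining d have μ(d) = 0), the sum
-- becomes a sum over the divisors of j weighted by χ(r/d): this is the general formula, and for
-- j ≤ 5 it reduces to closed forms of F(r, j), j ≤ 5.  For j = 0, writing (-1)^x = -1 + 2·[2 ∣ x]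
-- turns the sum into -Σ_{d∣r} μ(d) + 2 Σ_{d∣r/2} μ(d), which vanishes once r ≥ 3.  For the
-- asymptotics, the divisor d = 1 contributes F(r, j) with r^j ≤ j! F(r, j) ≤ r^j + O(r^(j-1)), and
-- each divisor d ≥ 2 contributes O(r^(j-1)); after dividing by r, everything but r^(j-1)/j! is
-- O(r^(j-2)), the stated second-order term included.

open import Level using (0ℓ)
open import Algebra.Bundles using (CommutativeMonoid)
open import Data.Bool.Base using (Bool; true; false; if_then_else_; _∧_; not; T)
import Data.Bool.Properties as BoolP
open import Data.Empty using (⊥-elim)
open import Data.Integer as ℤ using (ℤ; +_; -[1+_]; -1ℤ)
import Data.Integer.Properties as ℤP
open import Data.Integer.Tactic.RingSolver using (solve-∀)
open import Data.List using (_∷_; []; map; filter; foldr; length; upTo; applyUpTo)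
open import Data.List.Relation.Unary.All using (_∷_)
open import Data.List.Relation.Unary.Any.Properties using (any⁺; any⁻; applyUpTo⁺; applyUpTo⁻)
open import Data.Nat as ℕ using (ℕ; zero; suc; NonZero; _+_; _*_; _/_; _^_; _!; _∸_; _≤_; _<_; z≤n; s≤s; _≤ᵇ_)
import Data.Nat.Properties as ℕP
open import Data.Nat.Properties using (_!≢0)
open import Data.Nat.Coprimality using (Coprime; coprime-divisor)
open import Data.Nat.Divisibility using (_∣_; divides; _∣?_; ∣-refl; ∣-trans; ∣⇒≤; ∣m+n∣m⇒∣n; ∣m∣n⇒∣m+n)
import Data.Nat.Divisibility as ℕD
import Data.Nat.DivMod as ℕDM
open import Data.Nat.GCD using (gcd; gcd[m,n]∣m; gcd[m,n]∣n; gcd-greatest)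
import Data.Nat.GCD as ℕGCD
open import Data.Nat.ListAction using (sum; product)
open import Data.Nat.Primality using (Prime; prime?; euclidsLemma; prime⇒irreducible; prime⇒nonZero; prime⇒nonTrivial)
open import Data.Nat.Primality.Factorisation using (factorise)
import Data.Nat.Tactic.RingSolver as ℕSolver
open import Data.Product using (∃-syntax; _×_; _,_)
open import Data.Rational as ℚ using (ℚ; 0ℚ; 1ℚ; toℚᵘ)
import Data.Rational.Properties as ℚP
open import Data.Rational.Unnormalised as ℚᵘ using (mkℚᵘ)
import Data.Rational.Unnormalised.Properties as ℚᵘP
open import Data.Sum using (inj₁; inj₂)
open import Function using (_∘_; id)
open import Function.Bundles using (_⇔_; mk⇔; Equivalence)
open import Relation.Binary.PropositionalEquality
  using (_≡_; _≢_; refl; sym; trans; cong; cong₂; subst; subst₂; module ≡-Reasoning)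
open import Relation.Nullary using (does; Dec; yes; no; ¬_)
open import Relation.Nullary.Decidable using (dec-true; dec-false; does-⇔)
open import Relation.Unary using (Pred; Decidable)

open import Defs

module FiniteSum (M : CommutativeMonoid 0ℓ 0ℓ) where

  open CommutativeMonoid M renaming (refl to ≈-refl; sym to ≈-sym; trans to ≈-trans)
  open import Relation.Binary.Reasoning.Setoid setoid

  ∑ : ℕ → (ℕ → Carrier) → Carrier
  ∑ zero    f = ε
  ∑ (suc n) f = f 0 ∙ ∑ n (f ∘ suc)

  ∑-cong : ∀ n {f g} → (∀ k → k < n → f k ≈ g k) → ∑ n f ≈ ∑ n g
  ∑-cong zero    f≈g = ≈-refl
  ∑-cong (suc n) f≈g = ∙-cong (f≈g 0 (s≤s z≤n)) (∑-cong n (λ k k<n → f≈g (suc k) (s≤s k<n)))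

  ∑-zero : ∀ n {f} → (∀ k → k < n → f k ≈ ε) → ∑ n f ≈ ε
  ∑-zero zero    f≈ε = ≈-refl
  ∑-zero (suc n) f≈ε = ≈-trans (∙-cong (f≈ε 0 (s≤s z≤n)) (∑-zero n (λ k k<n → f≈ε (suc k) (s≤s k<n)))) (identityˡ ε)

  ∑-truncate : ∀ {m n f} → m ≤ n → (∀ k → m ≤ k → k < n → f k ≈ ε) → ∑ n f ≈ ∑ m f
  ∑-truncate {n = n} z≤n f≈ε = ∑-zero n (λ k → f≈ε k z≤n)
  ∑-truncate (s≤s m≤n) f≈ε = ∙-cong ≈-refl (∑-truncate m≤n (λ k m≤k k<n → f≈ε (suc k) (s≤s m≤k) (s≤s k<n)))

  ∑-++ : ∀ m n f → ∑ (m + n) f ≈ ∑ m f ∙ ∑ n (λ k → f (m + k))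
  ∑-++ zero    n f = ≈-sym (identityˡ _)
  ∑-++ (suc m) n f = ≈-trans (∙-cong ≈-refl (∑-++ m n (f ∘ suc))) (≈-sym (assoc _ _ _))

  ∑-distrib : ∀ n f g → ∑ n (λ k → f k ∙ g k) ≈ ∑ n f ∙ ∑ n g
  ∑-distrib zero    f g = ≈-sym (identityˡ ε)
  ∑-distrib (suc n) f g = begin
    (f 0 ∙ g 0) ∙ ∑ n (λ k → f (suc k) ∙ g (suc k)) ≈⟨ ∙-cong ≈-refl (∑-distrib n (f ∘ suc) (g ∘ suc)) ⟩
    (f 0 ∙ g 0) ∙ (∑ n (f ∘ suc) ∙ ∑ n (g ∘ suc))   ≈⟨ interchange (f 0) (g 0) _ _ ⟩
    (f 0 ∙ ∑ n (f ∘ suc)) ∙ (g 0 ∙ ∑ n (g ∘ suc))   ∎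
    where open import Algebra.Properties.CommutativeSemigroup commutativeSemigroup using (interchange)

  ∑-filter : ∀ {p} {P : Pred ℕ p} (P? : Decidable P) (g : ℕ → Carrier) (h : ℕ → ℕ) n →
    foldr _∙_ ε (map g (filter P? (applyUpTo h n))) ≈ ∑ n (λ k → if does (P? (h k)) then g (h k) else ε)
  ∑-filter P? g h zero = ≈-refl
  ∑-filter P? g h (suc n) with does (P? (h 0))
  ... | true  = ∙-cong ≈-refl (∑-filter P? g (h ∘ suc) n)
  ... | false = ≈-trans (∑-filter P? g (h ∘ suc) n) (≈-sym (identityˡ _))

  if-split : ∀ b x → x ≈ (if b then ε else x) ∙ (if b then x else ε)
  if-split true  x = ≈-sym (identityˡ x)
  if-split false x = ≈-sym (identityʳ x)

  ∑-multiples : ∀ m p .{{_ : NonZero p}} (g : ℕ → Carrier) →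
    ∑ (m * p) (λ k → if does (p ∣? suc k) then g (suc k) else ε) ≈ ∑ m (λ k → g (suc k * p))
  ∑-multiples zero    p g = ≈-refl
  ∑-multiples (suc m) p g = begin
    ∑ (p + m * p) f                                                      ≈⟨ ∑-++ p (m * p) f ⟩
    ∑ p f ∙ ∑ (m * p) (λ k → f (p + k))                                  ≈⟨ ∙-cong (last-block p g) (∑-cong (m * p) (λ k _ → reflexive (shift k))) ⟩
    g p ∙ ∑ (m * p) (λ k → if does (p ∣? suc k) then g (p + suc k) else ε) ≈⟨ ∙-cong (reflexive (cong g (sym (ℕP.+-identityʳ p)))) (∑-multiples m p (λ x → g (p + x))) ⟩
    g (p + 0) ∙ ∑ m (λ k → g (p + suc k * p))                            ∎
    where
    f : ℕ → Carrier
    f k = if does (p ∣? suc k) then g (suc k) else ε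
    shift : ∀ k → f (p + k) ≡ (if does (p ∣? suc k) then g (p + suc k) else ε)
    shift k = cong₂ (λ b x → if b then g x else ε)
      (does-⇔ (mk⇔ (λ p∣p+1+k → ∣m+n∣m⇒∣n (subst (p ∣_) (sym (ℕP.+-suc p k)) p∣p+1+k) ∣-refl)
                   (λ p∣1+k → subst (p ∣_) (ℕP.+-suc p k) (∣m∣n⇒∣m+n ∣-refl p∣1+k)))
              (p ∣? suc (p + k)) (p ∣? suc k))
      (sym (ℕP.+-suc p k))
    last-block : ∀ p .{{_ : NonZero p}} (g : ℕ → Carrier) → ∑ p (λ k → if does (p ∣? suc k) then g (suc k) else ε) ≈ g p
    last-block (suc p) g = begin
      ∑ (suc p) h                  ≈⟨ reflexive (cong (λ n → ∑ n h) (ℕP.+-comm 1 p)) ⟩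
      ∑ (p + 1) h                  ≈⟨ ∑-++ p 1 h ⟩
      ∑ p h ∙ (h (p + 0) ∙ ε)      ≈⟨ ∙-cong (∑-zero p (λ k k<p → reflexive (cong (λ b → if b then g (suc k) else ε)
                                                                (dec-false (suc p ∣? suc k) (λ p+1∣k+1 → ℕP.<⇒≱ (s≤s k<p) (∣⇒≤ p+1∣k+1))))))
                                            (identityʳ _) ⟩
      ε ∙ h (p + 0)                ≈⟨ identityˡ _ ⟩
      h (p + 0)                    ≈⟨ reflexive (cong h (ℕP.+-identityʳ p)) ⟩
      h p                          ≈⟨ reflexive (cong (λ b → if b then g (suc p) else ε) (dec-true (suc p ∣? suc p) ∣-refl)) ⟩
      g (suc p)                    ∎
      where
      h : ℕ → Carrier
      h k = if does (suc p ∣? suc k) then g (suc k) else ε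

module _ (M N : CommutativeMonoid 0ℓ 0ℓ) where
  private
    module M = CommutativeMonoid M
    module N = CommutativeMonoid N
    module ∑M = FiniteSum M
    module ∑N = FiniteSum N

  ∑-homo : (φ : M.Carrier → N.Carrier) → (∀ x y → φ (x M.∙ y) N.≈ φ x N.∙ φ y) → φ M.ε N.≈ N.ε →
           ∀ n f → φ (∑M.∑ n f) N.≈ ∑N.∑ n (φ ∘ f)
  ∑-homo φ φ-∙ φ-ε zero    f = φ-ε
  ∑-homo φ φ-∙ φ-ε (suc n) f = N.trans (φ-∙ _ _) (N.∙-cong N.refl (∑-homo φ φ-∙ φ-ε n (f ∘ suc)))

module Σℕ = FiniteSum ℕP.+-0-commutativeMonoid
module Σℤ = FiniteSum ℤP.+-0-commutativeMonoid
module Σℚ = FiniteSum ℚP.+-0-commutativeMonoid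

cong₃ : ∀ {A B C D : Set} (f : A → B → C → D) {x x′ y y′ z z′} → x ≡ x′ → y ≡ y′ → z ≡ z′ → f x y z ≡ f x′ y′ z′
cong₃ f refl refl refl = refl

-- Divisor sums

∑-neg : ∀ n f → Σℤ.∑ n (ℤ.-_ ∘ f) ≡ ℤ.- Σℤ.∑ n f
∑-neg n f = sym (∑-homo ℤP.+-0-commutativeMonoid ℤP.+-0-commutativeMonoid ℤ.-_ ℤP.neg-distrib-+ refl n f)

sumDivℤ≡∑ : ∀ n f → sumDivℤ n f ≡ Σℤ.∑ n (λ k → if does (suc k ∣? n) then f (suc k) else + 0)
sumDivℤ≡∑ n f = Σℤ.∑-filter (λ k → suc k ∣? n) (λ k → f (suc k)) id n

sumDiv≡∑ : ∀ n f → sumDiv n f ≡ Σℚ.∑ n (λ k → if does (suc k ∣? n) then f (suc k) else 0ℚ)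
sumDiv≡∑ n f = Σℚ.∑-filter (λ k → suc k ∣? n) (λ k → f (suc k)) id n

sumDivℤ-cong : ∀ n {f g : (d : ℕ) → .{{NonZero d}} → ℤ} → (∀ d → .{{_ : NonZero d}} → f d ≡ g d) → sumDivℤ n f ≡ sumDivℤ n g
sumDivℤ-cong n {f} {g} f≡g = begin
  sumDivℤ n f                                                   ≡⟨ sumDivℤ≡∑ n f ⟩
  Σℤ.∑ n (λ k → if does (suc k ∣? n) then f (suc k) else + 0)   ≡⟨ Σℤ.∑-cong n (λ k _ → cong (λ x → if does (suc k ∣? n) then x else + 0) (f≡g (suc k))) ⟩
  Σℤ.∑ n (λ k → if does (suc k ∣? n) then g (suc k) else + 0)   ≡⟨ sym (sumDivℤ≡∑ n g) ⟩
  sumDivℤ n g                                                   ∎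
  where open ≡-Reasoning

-- Powers of −1

data ParityView : ℕ → Set where
  even : ∀ e → ParityView (2 * e)
  odd  : ∀ e → ParityView (1 + 2 * e)

parityView : ∀ n → ParityView n
parityView zero = even 0
parityView (suc n) with parityView n
... | even e = odd e
... | odd e  = subst ParityView (ℕP.*-suc 2 e) (even (suc e))

2∤odd : ∀ e → ¬ 2 ∣ 1 + 2 * e
2∤odd e (divides q eq) = ℕP.even≢odd q e (trans (ℕP.*-comm 2 q) (sym eq))

2∣even : ∀ e → 2 ∣ 2 * e
2∣even e = divides e (ℕP.*-comm 2 e)

negOnePow≡-1^ : ∀ n → negOnePow n ≡ -1ℤ ℤ.^ n
negOnePow≡-1^ zero    = refl
negOnePow≡-1^ (suc n) = trans (cong ℤ.-_ (negOnePow≡-1^ n)) (sym (ℤP.-1*i≡-i _))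

negOnePow-+ : ∀ m n → negOnePow (m + n) ≡ negOnePow m ℤ.* negOnePow n
negOnePow-+ m n = begin
  negOnePow (m + n)               ≡⟨ negOnePow≡-1^ (m + n) ⟩
  -1ℤ ℤ.^ (m + n)                  ≡⟨ ℤP.^-distribˡ-+-* -1ℤ m n ⟩
  -1ℤ ℤ.^ m ℤ.* -1ℤ ℤ.^ n          ≡⟨ sym (cong₂ ℤ._*_ (negOnePow≡-1^ m) (negOnePow≡-1^ n)) ⟩
  negOnePow m ℤ.* negOnePow n     ∎
  where open ≡-Reasoning

negOnePow-even : ∀ n → negOnePow (2 * n) ≡ + 1
negOnePow-even n = begin
  negOnePow (2 * n)         ≡⟨ negOnePow≡-1^ (2 * n) ⟩
  -1ℤ ℤ.^ (2 * n)           ≡⟨ sym (ℤP.^-*-assoc -1ℤ 2 n) ⟩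
  (-1ℤ ℤ.^ 2) ℤ.^ n         ≡⟨ ℤP.^-zeroˡ n ⟩
  + 1                       ∎
  where open ≡-Reasoning

negOnePow-square : ∀ n → negOnePow n ℤ.* negOnePow n ≡ + 1
negOnePow-square n = begin
  negOnePow n ℤ.* negOnePow n ≡⟨ sym (negOnePow-+ n n) ⟩
  negOnePow (n + n)           ≡⟨ cong negOnePow (cong (λ x → n + x) (sym (ℕP.+-identityʳ n))) ⟩
  negOnePow (2 * n)           ≡⟨ negOnePow-even n ⟩
  + 1                         ∎
  where open ≡-Reasoning

negOnePow-*odd : ∀ q e → negOnePow (q * (1 + 2 * e)) ≡ negOnePow q
negOnePow-*odd q e = begin
  negOnePow (q * (1 + 2 * e))            ≡⟨ cong negOnePow (solve q e) ⟩
  negOnePow (q + 2 * (q * e))            ≡⟨ negOnePow-+ q (2 * (q * e)) ⟩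
  negOnePow q ℤ.* negOnePow (2 * (q * e)) ≡⟨ cong (negOnePow q ℤ.*_) (negOnePow-even (q * e)) ⟩
  negOnePow q ℤ.* + 1                    ≡⟨ ℤP.*-identityʳ (negOnePow q) ⟩
  negOnePow q                            ∎
  where
  open ≡-Reasoning
  solve : ∀ q e → q * (1 + 2 * e) ≡ q + 2 * (q * e)
  solve = ℕSolver.solve-∀

∣negOnePow∣≡1 : ∀ n → ℤ.∣ negOnePow n ∣ ≡ 1
∣negOnePow∣≡1 zero    = refl
∣negOnePow∣≡1 (suc n) = trans (ℤP.∣-i∣≡∣i∣ (negOnePow n)) (∣negOnePow∣≡1 n)

*negOnePow-expand : ∀ m x → m ℤ.* negOnePow x ≡ ℤ.- m ℤ.+ + 2 ℤ.* (if does (2 ∣? x) then m else + 0)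
*negOnePow-expand m x with 2 ∣? x
... | yes 2∣x@(divides q x≡q*2) = begin
  m ℤ.* negOnePow x                         ≡⟨ cong (λ y → m ℤ.* negOnePow y) (trans x≡q*2 (ℕP.*-comm q 2)) ⟩
  m ℤ.* negOnePow (2 * q)                   ≡⟨ cong (m ℤ.*_) (negOnePow-even q) ⟩
  m ℤ.* + 1                                 ≡⟨ solve m ⟩
  ℤ.- m ℤ.+ + 2 ℤ.* m                       ≡⟨ cong (λ b → ℤ.- m ℤ.+ + 2 ℤ.* (if b then m else + 0)) (sym (dec-true (2 ∣? x) 2∣x)) ⟩
  ℤ.- m ℤ.+ + 2 ℤ.* (if does (2 ∣? x) then m else + 0) ∎
  where
  open ≡-Reasoning
  solve : ∀ m → m ℤ.* + 1 ≡ ℤ.- m ℤ.+ + 2 ℤ.* m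
  solve = solve-∀
... | no 2∤x with parityView x
...   | even e = ⊥-elim (2∤x (2∣even e))
...   | odd e  = begin
  m ℤ.* ℤ.- negOnePow (2 * e)               ≡⟨ cong (λ y → m ℤ.* ℤ.- y) (negOnePow-even e) ⟩
  m ℤ.* ℤ.- + 1                             ≡⟨ solve m ⟩
  ℤ.- m ℤ.+ + 2 ℤ.* + 0                     ≡⟨ cong (λ b → ℤ.- m ℤ.+ + 2 ℤ.* (if b then m else + 0)) (sym (dec-false (2 ∣? 1 + 2 * e) 2∤x)) ⟩
  ℤ.- m ℤ.+ + 2 ℤ.* (if does (2 ∣? 1 + 2 * e) then m else + 0) ∎
  where
  open ≡-Reasoning
  solve : ∀ m → m ℤ.* ℤ.- + 1 ≡ ℤ.- m ℤ.+ + 2 ℤ.* + 0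
  solve = solve-∀

-- The Möbius function

isSquareFactorOf : ℕ → ℕ → Bool
isSquareFactorOf n k = (2 ≤ᵇ k) ∧ does ((k * k) ∣? n)

HasSquareFactor : ℕ → Set
HasSquareFactor n = ∃[ k ] 2 ≤ k × k * k ∣ n

hasSquareFactor⇒¬squarefree : ∀ n → .{{NonZero n}} → HasSquareFactor n → squarefree n ≡ false
hasSquareFactor⇒¬squarefree n (k , 2≤k , k²∣n) =
  cong not (Equivalence.to BoolP.T-≡ (any⁺ (isSquareFactorOf n) (applyUpTo⁺ id test (s≤s k≤n))))
  where
  k≤n : k ≤ n
  k≤n = ℕP.≤-trans (ℕP.m≤m*n k k {{ℕ.>-nonZero (ℕP.≤-trans (s≤s z≤n) 2≤k)}}) (∣⇒≤ k²∣n)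
  test : T (isSquareFactorOf n k)
  test = Equivalence.from BoolP.T-∧ (ℕP.≤⇒≤ᵇ 2≤k , Equivalence.from BoolP.T-≡ (dec-true ((k * k) ∣? n) k²∣n))

¬squarefree⇒hasSquareFactor : ∀ n → squarefree n ≡ false → HasSquareFactor n
¬squarefree⇒hasSquareFactor n sf≡false
  with k , _ , test ← applyUpTo⁻ id {n = suc n}
         (any⁻ (isSquareFactorOf n) (upTo (suc n)) (Equivalence.from BoolP.T-≡ (BoolP.not-injective sf≡false)))
  with 2≤ᵇk , k²∣?n ← Equivalence.to BoolP.T-∧ test
  = k , ℕP.≤ᵇ⇒≤ 2 k 2≤ᵇk , witness ((k * k) ∣? n) k²∣?n
  where
  witness : ∀ {a} {A : Set a} (a? : Dec A) → T (does a?) → A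
  witness (yes a) _ = a

squarefree-cong : ∀ m n → .{{NonZero m}} → .{{NonZero n}} →
                  (HasSquareFactor m ⇔ HasSquareFactor n) → squarefree m ≡ squarefree n
squarefree-cong m n m⇔n with squarefree m in eqm | squarefree n in eqn
... | true  | true  = refl
... | false | false = refl
... | true  | false = trans (sym eqm) (hasSquareFactor⇒¬squarefree m (Equivalence.from m⇔n (¬squarefree⇒hasSquareFactor n eqn)))
... | false | true  = trans (sym (hasSquareFactor⇒¬squarefree n (Equivalence.to m⇔n (¬squarefree⇒hasSquareFactor m eqm)))) eqn

indicator : ∀ {a} {A : Set a} → Dec A → ℕ
indicator a? = if does a? then 1 else 0

ω : ℕ → ℕ
ω n = length (filter (λ p → prime? p) (filter (λ d → d ∣? n) (upTo (suc n))))

primeDivisorIndicator : ℕ → ℕ → ℕ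
primeDivisorIndicator n q = if does (q ∣? n) then indicator (prime? q) else 0

length-filter-filter : ∀ {p q} {P : Pred ℕ p} {Q : Pred ℕ q} (P? : Decidable P) (Q? : Decidable Q) h n →
  length (filter P? (filter Q? (applyUpTo h n))) ≡ Σℕ.∑ n (λ k → if does (Q? (h k)) then indicator (P? (h k)) else 0)
length-filter-filter P? Q? h zero = refl
length-filter-filter P? Q? h (suc n) with Q? (h 0)
... | no _ = length-filter-filter P? Q? (h ∘ suc) n
... | yes _ with P? (h 0)
...   | yes _ = cong suc (length-filter-filter P? Q? (h ∘ suc) n)
...   | no _  = length-filter-filter P? Q? (h ∘ suc) n

ω≡∑ : ∀ n → ω n ≡ Σℕ.∑ (suc n) (primeDivisorIndicator n)
ω≡∑ n = length-filter-filter (λ p → prime? p) (λ d → d ∣? n) id (suc n)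

prime∤⇒coprime : ∀ {p m} → Prime p → ¬ p ∣ m → Coprime m p
prime∤⇒coprime pp p∤m (d∣m , d∣p) with prime⇒irreducible pp d∣p
... | inj₁ d≡1 = d≡1
... | inj₂ refl = ⊥-elim (p∤m d∣m)

prime∣*prime⇒∣ : ∀ {p q} e → Prime p → Prime q → q ≢ p → q ∣ e * p → q ∣ e
prime∣*prime⇒∣ e pp pq q≢p q∣ep with euclidsLemma e _ pq q∣ep
... | inj₁ q∣e = q∣e
... | inj₂ q∣p with prime⇒irreducible pp q∣p
...   | inj₁ refl = ⊥-elim (ℕ.nonTrivial⇒≢1 {{prime⇒nonTrivial pq}} refl)
...   | inj₂ q≡p  = ⊥-elim (q≢p q≡p)

primeDivisorIndicator-*prime : ∀ {e p} → Prime p → ¬ p ∣ e → ∀ q →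
  (if does (q ∣? e * p) then indicator (prime? q) else 0)
    ≡ (if does (q ∣? e) then indicator (prime? q) else 0) + indicator (q ℕ.≟ p)
primeDivisorIndicator-*prime {e} {p} pp p∤e q with prime? q
... | no ¬pq = begin
  (if does (q ∣? e * p) then 0 else 0)           ≡⟨ BoolP.if-eta (does (q ∣? e * p)) ⟩
  0                                              ≡⟨ sym (BoolP.if-eta (does (q ∣? e))) ⟩
  (if does (q ∣? e) then 0 else 0)               ≡⟨ sym (ℕP.+-identityʳ _) ⟩
  (if does (q ∣? e) then 0 else 0) + 0           ≡⟨ cong (λ b → (if does (q ∣? e) then 0 else 0) + (if b then 1 else 0))
                                                      (sym (dec-false (q ℕ.≟ p) (λ { refl → ¬pq pp }))) ⟩
  (if does (q ∣? e) then 0 else 0) + indicator (q ℕ.≟ p) ∎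
  where open ≡-Reasoning
... | yes pq with q ℕ.≟ p
...   | yes refl rewrite dec-true (q ∣? e * q) (ℕD.n∣m*n e) | dec-false (q ∣? e) p∤e | dec-true (q ℕ.≟ q) refl = refl
...   | no q≢p rewrite dec-false (q ℕ.≟ p) q≢p = trans (cong (λ b → if b then 1 else 0) (does-⇔ q∣ep⇔q∣e (q ∣? e * p) (q ∣? e)))
                         (sym (ℕP.+-identityʳ _))
  where
  q∣ep⇔q∣e : q ∣ e * p ⇔ q ∣ e
  q∣ep⇔q∣e = mk⇔ (prime∣*prime⇒∣ e pp pq q≢p) (ℕD.∣m⇒∣m*n p)

∑-indicator-≟ : ∀ {p} n → p < n → Σℕ.∑ n (λ q → indicator (q ℕ.≟ p)) ≡ 1
∑-indicator-≟ {zero}  (suc n) _ = cong suc (Σℕ.∑-zero n (λ _ _ → refl))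
∑-indicator-≟ {suc p} (suc n) (s≤s p<n) = ∑-indicator-≟ n p<n

ω-*prime : ∀ e p → .{{NonZero e}} → Prime p → ¬ p ∣ e → ω (e * p) ≡ suc (ω e)
ω-*prime e p pp p∤e = begin
  ω (e * p)                                                     ≡⟨ ω≡∑ (e * p) ⟩
  Σℕ.∑ (suc (e * p)) (primeDivisorIndicator (e * p))                 ≡⟨ Σℕ.∑-cong (suc (e * p)) (λ q _ → primeDivisorIndicator-*prime pp p∤e q) ⟩
  Σℕ.∑ (suc (e * p)) (λ q → primeDivisorIndicator e q + indicator (q ℕ.≟ p))
                                                                ≡⟨ Σℕ.∑-distrib (suc (e * p)) (primeDivisorIndicator e) (λ q → indicator (q ℕ.≟ p)) ⟩
  Σℕ.∑ (suc (e * p)) (primeDivisorIndicator e) + Σℕ.∑ (suc (e * p)) (λ q → indicator (q ℕ.≟ p))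
                                                                ≡⟨ cong₂ _+_ truncate (∑-indicator-≟ (suc (e * p)) p<1+ep) ⟩
  Σℕ.∑ (suc e) (primeDivisorIndicator e) + 1                         ≡⟨ ℕP.+-comm _ 1 ⟩
  suc (Σℕ.∑ (suc e) (primeDivisorIndicator e))                       ≡⟨ cong suc (sym (ω≡∑ e)) ⟩
  suc (ω e)                                                     ∎
  where
  open ≡-Reasoning
  instance
    p≢0 : NonZero p
    p≢0 = prime⇒nonZero pp
  p<1+ep : p < suc (e * p)
  p<1+ep = s≤s (ℕP.m≤n*m p e)
  truncate : Σℕ.∑ (suc (e * p)) (primeDivisorIndicator e) ≡ Σℕ.∑ (suc e) (primeDivisorIndicator e)
  truncate = Σℕ.∑-truncate (s≤s (ℕP.m≤m*n e p)) (λ q e<q _ →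
    cong (λ b → if b then indicator (prime? q) else 0) (dec-false (q ∣? e) (λ q∣e → ℕP.<⇒≱ e<q (∣⇒≤ q∣e))))

μ-squareFactor : ∀ n → .{{NonZero n}} → HasSquareFactor n → μ n ≡ + 0
μ-squareFactor n sq = cong (λ b → if b then negOnePow (ω n) else + 0) (hasSquareFactor⇒¬squarefree n sq)

μ-*prime-∣ : ∀ e p → .{{NonZero e}} → Prime p → p ∣ e → μ (e * p) ≡ + 0
μ-*prime-∣ e p pp p∣e = μ-squareFactor (e * p) (p , ℕ.nonTrivial⇒n>1 p , ℕD.*-pres-∣ p∣e ∣-refl)
  where
  instance
    p-nontrivial : ℕ.NonTrivial p
    p-nontrivial = prime⇒nonTrivial pp
    p≢0 : NonZero p
    p≢0 = prime⇒nonZero pp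
    ep≢0 : NonZero (e * p)
    ep≢0 = ℕP.m*n≢0 e p

μ-*prime-∤ : ∀ e p → .{{NonZero e}} → Prime p → ¬ p ∣ e → μ (e * p) ≡ ℤ.- μ e
μ-*prime-∤ e p pp p∤e = begin
  μ (e * p)                                            ≡⟨ cong₂ (λ b w → if b then negOnePow w else + 0)
                                                            (squarefree-cong (e * p) e (mk⇔ drop-p add-p)) (ω-*prime e p pp p∤e) ⟩
  (if squarefree e then ℤ.- negOnePow (ω e) else + 0) ≡⟨ sym (BoolP.if-float ℤ.-_ (squarefree e)) ⟩
  ℤ.- μ e                                              ∎
  where
  open ≡-Reasoning
  instance
    p≢0 : NonZero p
    p≢0 = prime⇒nonZero pp
    ep≢0 : NonZero (e * p)
    ep≢0 = ℕP.m*n≢0 e p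
  add-p : HasSquareFactor e → HasSquareFactor (e * p)
  add-p (k , 2≤k , k²∣e) = k , 2≤k , ℕD.∣m⇒∣m*n p k²∣e
  drop-p : HasSquareFactor (e * p) → HasSquareFactor e
  drop-p (k , 2≤k , k²∣ep) with p ∣? k
  ... | yes p∣k = ⊥-elim (p∤e (ℕD.*-cancelʳ-∣ p (∣-trans (ℕD.*-pres-∣ p∣k p∣k) k²∣ep)))
  ... | no p∤k  = k , 2≤k , coprime-divisor (prime∤⇒coprime pp p∤k²) (subst (k * k ∣_) (ℕP.*-comm e p) k²∣ep)
    where
    p∤k² : ¬ p ∣ k * k
    p∤k² p∣k² with euclidsLemma k k pp p∣k²
    ... | inj₁ p∣k = p∤k p∣k
    ... | inj₂ p∣k = p∤k p∣k

∣μ∣≤1 : ∀ d → ℤ.∣ μ d ∣ ≤ 1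
∣μ∣≤1 d = bound (squarefree d)
  where
  bound : ∀ b → ℤ.∣ (if b then negOnePow (ω d) else + 0) ∣ ≤ 1
  bound true  = ℕP.≤-reflexive (∣negOnePow∣≡1 (ω d))
  bound false = z≤n

primeFactor : ∀ n → 2 ≤ n → ∃[ p ] Prime p × p ∣ n
primeFactor n 2≤n with factorise n {{ℕ.>-nonZero (ℕP.≤-trans (s≤s z≤n) 2≤n)}}
... | record { factors = [] ; isFactorisation = n≡1 } = ⊥-elim (ℕP.<⇒≢ 2≤n (sym n≡1))
... | record { factors = p ∷ ps ; isFactorisation = n≡p*ps ; factorsPrime = pp ∷ _ } =
  p , pp , divides (product ps) (trans n≡p*ps (ℕP.*-comm p (product ps)))

-- Divisors of m p prime to p are the divisors of m prime to p; the others are e p with e ∣ m,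
-- and μ(e p) is -μ(e) or 0 according as p ∤ e or p ∣ e, so the two parts cancel.
∑∣μ≡0-*prime : ∀ m p → .{{NonZero m}} → Prime p → sumDivℤ (m * p) (λ d → μ d) ≡ + 0
∑∣μ≡0-*prime m p pp = begin
  sumDivℤ n (λ d → μ d)                                      ≡⟨ sumDivℤ≡∑ n (λ d → μ d) ⟩
  Σℤ.∑ n (λ k → [ suc k ∣ n ]μ)                             ≡⟨ Σℤ.∑-cong n (λ k _ → Σℤ.if-split (does (p ∣? suc k)) _) ⟩
  Σℤ.∑ n (λ k → coprimePart k ℤ.+ multiplePart k)           ≡⟨ Σℤ.∑-distrib n coprimePart multiplePart ⟩
  Σℤ.∑ n coprimePart ℤ.+ Σℤ.∑ n multiplePart               ≡⟨ cong₂ ℤ._+_ ∑coprimePart ∑multiplePart ⟩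
  S ℤ.+ ℤ.- S                                              ≡⟨ ℤP.+-inverseʳ S ⟩
  + 0                                                      ∎
  where
  open ≡-Reasoning
  instance
    p≢0 : NonZero p
    p≢0 = prime⇒nonZero pp
  n : ℕ
  n = m * p
  [_∣_]μ : ℕ → ℕ → ℤ
  [ d ∣ n' ]μ = if does (d ∣? n') then μ d else + 0
  coprimePart multiplePart : ℕ → ℤ
  coprimePart k = if does (p ∣? suc k) then + 0 else [ suc k ∣ n ]μ
  multiplePart k = if does (p ∣? suc k) then [ suc k ∣ n ]μ else + 0
  coprimePartₘ : ℕ → ℤ
  coprimePartₘ k = if does (p ∣? suc k) then + 0 else [ suc k ∣ m ]μ
  S : ℤ
  S = Σℤ.∑ m coprimePartₘ

  coprime-∣ : ∀ {d} → ¬ p ∣ d → d ∣ m * p ⇔ d ∣ m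
  coprime-∣ {d} p∤d = mk⇔ (λ d∣mp → coprime-divisor (prime∤⇒coprime pp p∤d) (subst (d ∣_) (ℕP.*-comm m p) d∣mp))
                      (ℕD.∣m⇒∣m*n p)

  coprimePart≡ : ∀ k → coprimePart k ≡ coprimePartₘ k
  coprimePart≡ k with p ∣? suc k
  ... | yes _   = refl
  ... | no p∤d = cong (λ b → if b then μ (suc k) else + 0) (does-⇔ (coprime-∣ p∤d) (suc k ∣? n) (suc k ∣? m))

  ∑coprimePart : Σℤ.∑ n coprimePart ≡ S
  ∑coprimePart = trans
    (Σℤ.∑-truncate (ℕP.m≤m*n m p) (λ k m≤k _ → trans (coprimePart≡ k) (beyond k m≤k)))
    (Σℤ.∑-cong m (λ k _ → coprimePart≡ k))
    where
    beyond : ∀ k → m ≤ k → coprimePartₘ k ≡ + 0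
    beyond k m≤k = trans (cong (λ b → if does (p ∣? suc k) then + 0 else (if b then μ (suc k) else + 0))
                                (dec-false (suc k ∣? m) (λ d∣m → ℕP.<⇒≱ (s≤s m≤k) (∣⇒≤ d∣m))))
                         (BoolP.if-eta (does (p ∣? suc k)))

  multiple≡ : ∀ k → [ suc k * p ∣ n ]μ ≡ ℤ.- coprimePartₘ k
  multiple≡ k with p ∣? suc k
  ... | yes p∣e = trans (cong (λ x → if does (suc k * p ∣? n) then x else + 0) (μ-*prime-∣ (suc k) p pp p∣e))
                        (BoolP.if-eta (does (suc k * p ∣? n)))
  ... | no p∤e = begin
    [ suc k * p ∣ n ]μ                                      ≡⟨ cong₂ (λ b x → if b then x else + 0)
                                                                 (does-⇔ (mk⇔ (ℕD.*-cancelʳ-∣ p) (λ e∣m → ℕD.*-pres-∣ e∣m ∣-refl))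
                                                                         (suc k * p ∣? n) (suc k ∣? m))
                                                                 (μ-*prime-∤ (suc k) p pp p∤e) ⟩
    (if does (suc k ∣? m) then ℤ.- μ (suc k) else + 0)      ≡⟨ sym (BoolP.if-float ℤ.-_ (does (suc k ∣? m))) ⟩
    ℤ.- [ suc k ∣ m ]μ                                      ∎

  ∑multiplePart : Σℤ.∑ n multiplePart ≡ ℤ.- S
  ∑multiplePart = begin
    Σℤ.∑ n multiplePart                          ≡⟨ Σℤ.∑-multiples m p (λ d → [ d ∣ n ]μ) ⟩
    Σℤ.∑ m (λ k → [ suc k * p ∣ n ]μ)            ≡⟨ Σℤ.∑-cong m (λ k _ → multiple≡ k) ⟩
    Σℤ.∑ m (ℤ.-_ ∘ coprimePartₘ)                 ≡⟨ ∑-neg m coprimePartₘ ⟩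
    ℤ.- S                                        ∎

∑∣μ≡0 : ∀ n → 2 ≤ n → sumDivℤ n (λ d → μ d) ≡ + 0
∑∣μ≡0 n 2≤n with primeFactor n 2≤n
... | p , pp , divides zero    refl = ⊥-elim (ℕP.<⇒≱ 2≤n z≤n)
... | p , pp , divides (suc m) refl = ∑∣μ≡0-*prime (suc m) p pp

-- Fractions

toℚᵘ-/ : ∀ a n → .{{_ : NonZero n}} → toℚᵘ (a ℚ./ n) ℚᵘ.≃ a ℚᵘ./ n
toℚᵘ-/ a (suc n) = ℚP.toℚᵘ-fromℚᵘ (mkℚᵘ a n)

/-≡ : ∀ a b n m → .{{_ : NonZero n}} → .{{_ : NonZero m}} → a ℤ.* + m ≡ b ℤ.* + n → a ℚ./ n ≡ b ℚ./ m
/-≡ a b (suc n) (suc m) eq = ℚP.fromℚᵘ-cong {mkℚᵘ a n} {mkℚᵘ b m} (ℚᵘ.*≡* eq)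

/-+-/ : ∀ a b n m → .{{_ : NonZero n}} → .{{_ : NonZero m}} →
        (a ℚ./ n) ℚ.+ (b ℚ./ m) ≡ ((a ℤ.* + m ℤ.+ b ℤ.* + n) ℚ./ (n * m)) {{ℕP.m*n≢0 n m}}
/-+-/ a b n@(suc _) m@(suc _) = ℚP.toℚᵘ-injective (ℚᵘP.≃-trans (ℚP.toℚᵘ-homo-+ (a ℚ./ n) (b ℚ./ m))
  (ℚᵘP.≃-trans (ℚᵘP.+-cong (toℚᵘ-/ a n) (toℚᵘ-/ b m)) (ℚᵘP.≃-sym (toℚᵘ-/ (a ℤ.* + m ℤ.+ b ℤ.* + n) (n * m)))))

/-*-/ : ∀ a b n m → .{{_ : NonZero n}} → .{{_ : NonZero m}} →
        (a ℚ./ n) ℚ.* (b ℚ./ m) ≡ ((a ℤ.* b) ℚ./ (n * m)) {{ℕP.m*n≢0 n m}}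
/-*-/ a b n@(suc _) m@(suc _) = ℚP.toℚᵘ-injective (ℚᵘP.≃-trans (ℚP.toℚᵘ-homo-* (a ℚ./ n) (b ℚ./ m))
  (ℚᵘP.≃-trans (ℚᵘP.*-cong (toℚᵘ-/ a n) (toℚᵘ-/ b m)) (ℚᵘP.≃-sym (toℚᵘ-/ (a ℤ.* b) (n * m)))))

-‿/ : ∀ a n → .{{_ : NonZero n}} → ℚ.- (a ℚ./ n) ≡ (ℤ.- a) ℚ./ n
-‿/ a n@(suc _) = ℚP.toℚᵘ-injective (ℚᵘP.≃-trans (ℚP.toℚᵘ-homo‿- (a ℚ./ n))
  (ℚᵘP.≃-trans (ℚᵘP.-‿cong (toℚᵘ-/ a n)) (ℚᵘP.≃-sym (toℚᵘ-/ (ℤ.- a) n))))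

/-distrib-+ : ∀ a b n → .{{_ : NonZero n}} → (a ℤ.+ b) ℚ./ n ≡ (a ℚ./ n) ℚ.+ (b ℚ./ n)
/-distrib-+ a b n = sym (trans (/-+-/ a b n n)
  (/-≡ (a ℤ.* + n ℤ.+ b ℤ.* + n) (a ℤ.+ b) (n * n) n {{ℕP.m*n≢0 n n}}
       (trans (solve a b (+ n)) (cong ((a ℤ.+ b) ℤ.*_) (sym (ℤP.pos-* n n))))))
  where
  solve : ∀ a b n → (a ℤ.* n ℤ.+ b ℤ.* n) ℤ.* n ≡ (a ℤ.+ b) ℤ.* (n ℤ.* n)
  solve = solve-∀

∣/∣ : ∀ a n → .{{_ : NonZero n}} → ℚ.∣ a ℚ./ n ∣ ≡ + ℤ.∣ a ∣ ℚ./ n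
∣/∣ a n@(suc _) = ℚP.toℚᵘ-injective (ℚᵘP.≃-trans (ℚP.toℚᵘ-homo-∣-∣ (a ℚ./ n))
  (ℚᵘP.≃-trans (ℚᵘP.∣-∣-cong (toℚᵘ-/ a n)) (ℚᵘP.≃-sym (toℚᵘ-/ (+ ℤ.∣ a ∣) n))))

/-≤ : ∀ a b n m → .{{_ : NonZero n}} → .{{_ : NonZero m}} → a * m ≤ b * n → + a ℚ./ n ℚ.≤ + b ℚ./ m
/-≤ a b n@(suc _) m@(suc _) a*m≤b*n = ℚP.toℚᵘ-cancel-≤
  (ℚᵘP.≤-respˡ-≃ (ℚᵘP.≃-sym (toℚᵘ-/ (+ a) n)) (ℚᵘP.≤-respʳ-≃ (ℚᵘP.≃-sym (toℚᵘ-/ (+ b) m))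
    (ℚᵘ.*≤* (subst₂ ℤ._≤_ (ℤP.pos-* a m) (ℤP.pos-* b n) (ℤ.+≤+ a*m≤b*n)))))

-- Convolved Fibonacci numbers

F-zero : ∀ r → F r 0 ≡ 1
F-zero zero    = refl
F-zero (suc r) = cong (λ x → x + 0 + 0) (F-zero r)

F-one : ∀ r → F r 1 ≡ r
F-one zero    = refl
F-one (suc r) rewrite F-one r | F-zero r = solve r
  where
  solve : ∀ r → r + 0 + (1 + 0) ≡ suc r
  solve = ℕSolver.solve-∀

F-two : ∀ r → 2 * F r 2 ≡ (3 + r) * r
F-two zero    = refl
F-two (suc r) = begin
  2 * F (suc r) 2                   ≡⟨ unfold (F r 2) (F r 1) (F r 0) ⟩
  2 * F r 2 + 2 * F r 1 + 4 * F r 0 ≡⟨ cong₂ (λ a b → a + 2 * b + 4 * F r 0) (F-two r) (F-one r) ⟩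
  (3 + r) * r + 2 * r + 4 * F r 0   ≡⟨ cong (λ c → (3 + r) * r + 2 * r + 4 * c) (F-zero r) ⟩
  (3 + r) * r + 2 * r + 4 * 1       ≡⟨ solve r ⟩
  (3 + suc r) * suc r               ∎
  where
  open ≡-Reasoning
  -- The left side is 2 * F (suc r) 2 unfolded: F (suc r) k = Σ_{i ≤ k} fibInv i * F r (k ∸ i).
  unfold : ∀ x₂ x₁ x₀ → 2 * (1 * x₂ + (1 * x₁ + (2 * x₀ + 0))) ≡ 2 * x₂ + 2 * x₁ + 4 * x₀
  unfold = ℕSolver.solve-∀
  solve : ∀ r → (3 + r) * r + 2 * r + 4 * 1 ≡ (3 + (1 + r)) * (1 + r)
  solve = ℕSolver.solve-∀

F-three : ∀ r → 6 * F r 3 ≡ (8 + 9 * r + r ^ 2) * r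
F-three zero    = refl
F-three (suc r) = begin
  6 * F (suc r) 3                                      ≡⟨ unfold (F r 3) (F r 2) (F r 1) (F r 0) ⟩
  6 * F r 3 + 3 * (2 * F r 2) + 12 * F r 1 + 18 * F r 0 ≡⟨ cong₂ (λ a b → a + 3 * b + 12 * F r 1 + 18 * F r 0) (F-three r) (F-two r) ⟩
  (8 + 9 * r + r ^ 2) * r + 3 * ((3 + r) * r) + 12 * F r 1 + 18 * F r 0
                                                       ≡⟨ cong₂ (λ b c → (8 + 9 * r + r ^ 2) * r + 3 * ((3 + r) * r) + 12 * b + 18 * c) (F-one r) (F-zero r) ⟩
  (8 + 9 * r + r ^ 2) * r + 3 * ((3 + r) * r) + 12 * r + 18 * 1
                                                       ≡⟨ solve r ⟩
  (8 + 9 * suc r + suc r ^ 2) * suc r                  ∎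
  where
  open ≡-Reasoning
  unfold : ∀ x₃ x₂ x₁ x₀ → 6 * (1 * x₃ + (1 * x₂ + (2 * x₁ + (3 * x₀ + 0)))) ≡ 6 * x₃ + 3 * (2 * x₂) + 12 * x₁ + 18 * x₀
  unfold = ℕSolver.solve-∀
  -- r ^ 2 unfolds to r * (r * 1), the form the solver must be given.
  solve : ∀ r → (8 + 9 * r + r * (r * 1)) * r + 3 * ((3 + r) * r) + 12 * r + 18 * 1 ≡ (8 + 9 * (1 + r) + (1 + r) * ((1 + r) * 1)) * (1 + r)
  solve = ℕSolver.solve-∀

F-four : ∀ r → 24 * F r 4 ≡ (42 + 59 * r + 18 * r ^ 2 + r ^ 3) * r
F-four zero    = refl
F-four (suc r) = begin
  24 * F (suc r) 4
    ≡⟨ unfold (F r 4) (F r 3) (F r 2) (F r 1) (F r 0) ⟩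
  24 * F r 4 + 4 * (6 * F r 3) + 24 * (2 * F r 2) + 72 * F r 1 + 120 * F r 0
    ≡⟨ cong₂ (λ a b → a + 4 * b + 24 * (2 * F r 2) + 72 * F r 1 + 120 * F r 0) (F-four r) (F-three r) ⟩
  P₄ * r + 4 * (P₃ * r) + 24 * (2 * F r 2) + 72 * F r 1 + 120 * F r 0
    ≡⟨ cong₂ (λ a b → P₄ * r + 4 * (P₃ * r) + 24 * a + 72 * b + 120 * F r 0) (F-two r) (F-one r) ⟩
  P₄ * r + 4 * (P₃ * r) + 24 * ((3 + r) * r) + 72 * r + 120 * F r 0
    ≡⟨ cong (λ c → P₄ * r + 4 * (P₃ * r) + 24 * ((3 + r) * r) + 72 * r + 120 * c) (F-zero r) ⟩
  P₄ * r + 4 * (P₃ * r) + 24 * ((3 + r) * r) + 72 * r + 120 * 1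
    ≡⟨ solve r ⟩
  (42 + 59 * suc r + 18 * suc r ^ 2 + suc r ^ 3) * suc r
    ∎
  where
  open ≡-Reasoning
  P₃ : ℕ
  P₃ = 8 + 9 * r + r ^ 2
  P₄ : ℕ
  P₄ = 42 + 59 * r + 18 * r ^ 2 + r ^ 3
  unfold : ∀ x₄ x₃ x₂ x₁ x₀ → 24 * (1 * x₄ + (1 * x₃ + (2 * x₂ + (3 * x₁ + (5 * x₀ + 0)))))
                             ≡ 24 * x₄ + 4 * (6 * x₃) + 24 * (2 * x₂) + 72 * x₁ + 120 * x₀
  unfold = ℕSolver.solve-∀
  solve : ∀ r → (42 + 59 * r + 18 * (r * (r * 1)) + r * (r * (r * 1))) * r + 4 * ((8 + 9 * r + r * (r * 1)) * r)
                + 24 * ((3 + r) * r) + 72 * r + 120 * 1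
              ≡ (42 + 59 * (1 + r) + 18 * ((1 + r) * ((1 + r) * 1)) + (1 + r) * ((1 + r) * ((1 + r) * 1))) * (1 + r)
  solve = ℕSolver.solve-∀

F-five : ∀ r → 120 * F r 5 ≡ (264 + 450 * r + 215 * r ^ 2 + 30 * r ^ 3 + r ^ 4) * r
F-five zero    = refl
F-five (suc r) = begin
  120 * F (suc r) 5
    ≡⟨ unfold (F r 5) (F r 4) (F r 3) (F r 2) (F r 1) (F r 0) ⟩
  120 * F r 5 + 5 * (24 * F r 4) + 40 * (6 * F r 3) + 180 * (2 * F r 2) + 600 * F r 1 + 960 * F r 0
    ≡⟨ cong₂ (λ a b → a + 5 * b + 40 * (6 * F r 3) + 180 * (2 * F r 2) + 600 * F r 1 + 960 * F r 0) (F-five r) (F-four r) ⟩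
  P₅ * r + 5 * (P₄ * r) + 40 * (6 * F r 3) + 180 * (2 * F r 2) + 600 * F r 1 + 960 * F r 0
    ≡⟨ cong₂ (λ a b → P₅ * r + 5 * (P₄ * r) + 40 * a + 180 * b + 600 * F r 1 + 960 * F r 0) (F-three r) (F-two r) ⟩
  P₅ * r + 5 * (P₄ * r) + 40 * (P₃ * r) + 180 * ((3 + r) * r) + 600 * F r 1 + 960 * F r 0
    ≡⟨ cong₂ (λ a b → P₅ * r + 5 * (P₄ * r) + 40 * (P₃ * r) + 180 * ((3 + r) * r) + 600 * a + 960 * b) (F-one r) (F-zero r) ⟩
  P₅ * r + 5 * (P₄ * r) + 40 * (P₃ * r) + 180 * ((3 + r) * r) + 600 * r + 960 * 1
    ≡⟨ solve r ⟩
  (264 + 450 * suc r + 215 * suc r ^ 2 + 30 * suc r ^ 3 + suc r ^ 4) * suc r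
    ∎
  where
  open ≡-Reasoning
  P₃ : ℕ
  P₃ = 8 + 9 * r + r ^ 2
  P₄ : ℕ
  P₄ = 42 + 59 * r + 18 * r ^ 2 + r ^ 3
  P₅ : ℕ
  P₅ = 264 + 450 * r + 215 * r ^ 2 + 30 * r ^ 3 + r ^ 4
  unfold : ∀ x₅ x₄ x₃ x₂ x₁ x₀ → 120 * (1 * x₅ + (1 * x₄ + (2 * x₃ + (3 * x₂ + (5 * x₁ + (8 * x₀ + 0))))))
                                ≡ 120 * x₅ + 5 * (24 * x₄) + 40 * (6 * x₃) + 180 * (2 * x₂) + 600 * x₁ + 960 * x₀
  unfold = ℕSolver.solve-∀
  solve : ∀ r → (264 + 450 * r + 215 * (r * (r * 1)) + 30 * (r * (r * (r * 1))) + r * (r * (r * (r * 1)))) * r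
                + 5 * ((42 + 59 * r + 18 * (r * (r * 1)) + r * (r * (r * 1))) * r)
                + 40 * ((8 + 9 * r + r * (r * 1)) * r) + 180 * ((3 + r) * r) + 600 * r + 960 * 1
              ≡ (264 + 450 * (1 + r) + 215 * ((1 + r) * ((1 + r) * 1)) + 30 * ((1 + r) * ((1 + r) * ((1 + r) * 1)))
                 + (1 + r) * ((1 + r) * ((1 + r) * ((1 + r) * 1)))) * (1 + r)
  solve = ℕSolver.solve-∀

p*F[r/p,1]≡r : ∀ r p → .{{_ : NonZero p}} → p ∣ r → p * F (r / p) 1 ≡ r
p*F[r/p,1]≡r r p p∣r = trans (cong (p *_) (F-one (r / p))) (ℕDM.m*[n/m]≡n p∣r)

24*F[r/2,2]≡[18+3r]*r : ∀ r → 2 ∣ r → 24 * F (r / 2) 2 ≡ (18 + 3 * r) * r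
24*F[r/2,2]≡[18+3r]*r r (divides q refl) = begin
  24 * F (q * 2 / 2) 2        ≡⟨ cong (λ x → 24 * F x 2) (ℕDM.m*n/n≡m q 2) ⟩
  24 * F q 2                  ≡⟨ ℕP.*-assoc 12 2 (F q 2) ⟩
  12 * (2 * F q 2)            ≡⟨ cong (12 *_) (F-two q) ⟩
  12 * ((3 + q) * q)          ≡⟨ solve q ⟩
  (18 + 3 * (q * 2)) * (q * 2) ∎
  where
  open ≡-Reasoning
  solve : ∀ q → 12 * ((3 + q) * q) ≡ (18 + 3 * (q * 2)) * (q * 2)
  solve = ℕSolver.solve-∀

sum-map : ∀ (f : ℕ → ℕ) h n → sum (map f (applyUpTo h n)) ≡ Σℕ.∑ n (f ∘ h)
sum-map f h zero    = refl
sum-map f h (suc n) = cong (λ x → f (h 0) + x) (sum-map f (h ∘ suc) n)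

fibInv-convolution : (ℕ → ℕ) → ℕ → ℕ
fibInv-convolution G k = Σℕ.∑ (suc k) (λ i → fibInv i * G (k ∸ i))

F-suc : ∀ r k → F (suc r) k ≡ fibInv-convolution (F r) k
F-suc r k = sum-map (λ i → fibInv i * F r (k ∸ i)) id (suc k)

fibInv-convolution-recurrence : ∀ G k →
  fibInv-convolution G (2 + k) ≡ G (2 + k) + fibInv-convolution G (1 + k) + fibInv-convolution G k
fibInv-convolution-recurrence G k = begin
  1 * G (2 + k) + (1 * G (1 + k) + Σℕ.∑ (suc k) (λ i → fibInv (2 + i) * G (k ∸ i)))
    ≡⟨ cong (λ x → 1 * G (2 + k) + (1 * G (1 + k) + x))
            (trans (Σℕ.∑-cong (suc k) (λ i _ → ℕP.*-distribʳ-+ (G (k ∸ i)) (fibInv (suc i)) (fibInv i)))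
                   (Σℕ.∑-distrib (suc k) (λ i → fibInv (suc i) * G (k ∸ i)) (λ i → fibInv i * G (k ∸ i)))) ⟩
  1 * G (2 + k) + (1 * G (1 + k) + (S₁ + S₀))
    ≡⟨ solve (G (2 + k)) (G (1 + k)) S₁ S₀ ⟩
  G (2 + k) + (1 * G (1 + k) + S₁) + S₀
    ∎
  where
  open ≡-Reasoning
  S₁ : ℕ
  S₁ = Σℕ.∑ (suc k) (λ i → fibInv (suc i) * G (k ∸ i))
  S₀ : ℕ
  S₀ = Σℕ.∑ (suc k) (λ i → fibInv i * G (k ∸ i))
  solve : ∀ a b c d → 1 * a + (1 * b + (c + d)) ≡ a + (1 * b + c) + d
  solve = ℕSolver.solve-∀

F-recurrence : ∀ r k → F (suc r) (2 + k) ≡ F r (2 + k) + F (suc r) (1 + k) + F (suc r) k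
F-recurrence r k = begin
  F (suc r) (2 + k)                                                          ≡⟨ F-suc r (2 + k) ⟩
  fibInv-convolution (F r) (2 + k)                                           ≡⟨ fibInv-convolution-recurrence (F r) k ⟩
  F r (2 + k) + fibInv-convolution (F r) (1 + k) + fibInv-convolution (F r) k ≡⟨ sym (cong₂ (λ a b → F r (2 + k) + a + b) (F-suc r (1 + k)) (F-suc r k)) ⟩
  F r (2 + k) + F (suc r) (1 + k) + F (suc r) k                              ∎
  where open ≡-Reasoning

F-recurrence-≤ : ∀ r k → F r (suc k) + F (suc r) k ≤ F (suc r) (suc k)
F-recurrence-≤ r zero    = ℕP.≤-reflexive (trans (cong₂ _+_ (F-one r) (F-zero (suc r))) (trans (ℕP.+-comm r 1) (sym (F-one (suc r)))))
F-recurrence-≤ r (suc k) = ℕP.≤-trans (ℕP.m≤m+n _ (F (suc r) k)) (ℕP.≤-reflexive (sym (F-recurrence r k)))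

binomial-lower : ∀ x m → x ^ suc m + suc m * x ^ m ≤ suc x ^ suc m
binomial-lower x zero    = ℕP.≤-reflexive (solve x)
  where
  solve : ∀ x → x * 1 + 1 * 1 ≡ (1 + x) * 1
  solve = ℕSolver.solve-∀
binomial-lower x (suc m) = begin
  x ^ suc (suc m) + suc (suc m) * x ^ suc m      ≡⟨ solve₁ x (x ^ m) m ⟩
  x * (x * y) + (x * y + suc m * (x * y))        ≤⟨ ℕP.m≤m+n _ (suc m * y) ⟩
  x * (x * y) + (x * y + suc m * (x * y)) + suc m * y ≡⟨ solve₂ x y m ⟩
  suc x * (x ^ suc m + suc m * x ^ m)            ≤⟨ ℕP.*-monoʳ-≤ (suc x) (binomial-lower x m) ⟩
  suc x ^ suc (suc m)                            ∎
  where
  open ℕP.≤-Reasoning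
  y : ℕ
  y = x ^ m
  solve₁ : ∀ x y m → x * (x * y) + (2 + m) * (x * y) ≡ x * (x * y) + (x * y + (1 + m) * (x * y))
  solve₁ = ℕSolver.solve-∀
  solve₂ : ∀ x y m → x * (x * y) + (x * y + (1 + m) * (x * y)) + (1 + m) * y ≡ (1 + x) * (x * y + (1 + m) * y)
  solve₂ = ℕSolver.solve-∀

binomial-upper : ∀ b c k → (b + c) ^ suc k ≤ b ^ suc k + suc k * c * (b + c) ^ k
binomial-upper b c zero    = ℕP.≤-reflexive (solve b c)
  where
  solve : ∀ b c → (b + c) * 1 ≡ b * 1 + 1 * c * 1
  solve = ℕSolver.solve-∀
binomial-upper b c (suc k) = begin
  (b + c) * (b + c) ^ suc k                                     ≤⟨ ℕP.*-monoʳ-≤ (b + c) (binomial-upper b c k) ⟩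
  (b + c) * (b ^ suc k + suc k * c * (b + c) ^ k)              ≡⟨ solve₁ b c k (b ^ suc k) ((b + c) ^ k) ⟩
  b * b ^ suc k + (c * b ^ suc k + suc k * c * (b + c) ^ suc k) ≤⟨ ℕP.+-monoʳ-≤ (b * b ^ suc k)
                                                                     (ℕP.+-monoˡ-≤ (suc k * c * (b + c) ^ suc k)
                                                                       (ℕP.*-monoʳ-≤ c (ℕP.^-monoˡ-≤ (suc k) (ℕP.m≤m+n b c)))) ⟩
  b * b ^ suc k + (c * (b + c) ^ suc k + suc k * c * (b + c) ^ suc k) ≡⟨ solve₂ b c k (b ^ suc k) ((b + c) ^ suc k) ⟩
  b ^ suc (suc k) + suc (suc k) * c * (b + c) ^ suc k           ∎
  where
  open ℕP.≤-Reasoning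
  solve₁ : ∀ b c k B P → (b + c) * (B + (1 + k) * c * P) ≡ b * B + (c * B + (1 + k) * c * ((b + c) * P))
  solve₁ = ℕSolver.solve-∀
  solve₂ : ∀ b c k B P → b * B + (c * P + (1 + k) * c * P) ≡ b * B + (2 + k) * c * P
  solve₂ = ℕSolver.solve-∀

k!*F≤[r+2k]^k : ∀ k r → k ! * F r k ≤ (r + 2 * k) ^ k
k!*F≤[r+2k]^k zero r = ℕP.≤-reflexive (trans (ℕP.*-identityˡ (F r 0)) (F-zero r))
k!*F≤[r+2k]^k (suc zero) r = begin
  1 * F r 1          ≡⟨ trans (ℕP.*-identityˡ (F r 1)) (F-one r) ⟩
  r                  ≤⟨ ℕP.m≤m+n r 2 ⟩
  r + 2              ≡⟨ sym (ℕP.*-identityʳ (r + 2)) ⟩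
  (r + 2 * 1) ^ 1    ∎
  where open ℕP.≤-Reasoning
k!*F≤[r+2k]^k (suc (suc k)) zero = ℕP.≤-trans (ℕP.≤-reflexive (ℕP.*-zeroʳ (suc (suc k) !))) z≤n
k!*F≤[r+2k]^k (suc (suc k)) (suc r) = begin
  (2 + k) ! * F (suc r) (2 + k)
    ≡⟨ cong ((2 + k) ! *_) (F-recurrence r k) ⟩
  (2 + k) ! * (F r (2 + k) + F (suc r) (1 + k) + F (suc r) k)
    ≡⟨ solve (2 + k) (1 + k) (k !) (F r (2 + k)) (F (suc r) (1 + k)) (F (suc r) k) ⟩
  (2 + k) ! * F r (2 + k) + (2 + k) * ((1 + k) ! * F (suc r) (1 + k)) + (2 + k) * (1 + k) * (k ! * F (suc r) k)
    ≤⟨ ℕP.+-mono-≤ (ℕP.+-mono-≤ (k!*F≤[r+2k]^k (suc (suc k)) r) (ℕP.*-monoʳ-≤ (2 + k) (k!*F≤[r+2k]^k (suc k) (suc r))))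
                   (ℕP.*-monoʳ-≤ ((2 + k) * (1 + k)) (k!*F≤[r+2k]^k k (suc r))) ⟩
  (r + 2 * (2 + k)) ^ (2 + k) + (2 + k) * (suc r + 2 * (1 + k)) ^ (1 + k) + (2 + k) * (1 + k) * (suc r + 2 * k) ^ k
    ≡⟨ cong₂ (λ a b → a ^ (2 + k) + (2 + k) * b ^ (1 + k) + (2 + k) * (1 + k) * t ^ k) (solve₁ r k) (solve₂ r k) ⟩
  (3 + t) ^ (2 + k) + (2 + k) * (2 + t) ^ (1 + k) + (2 + k) * (1 + k) * t ^ k
    ≤⟨ ℕP.+-monoʳ-≤ ((3 + t) ^ (2 + k) + (2 + k) * (2 + t) ^ (1 + k)) (ℕP.*-monoʳ-≤ ((2 + k) * (1 + k)) (ℕP.^-monoˡ-≤ k (ℕP.m≤n+m t 2))) ⟩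
  (3 + t) ^ (2 + k) + (2 + k) * (2 + t) ^ (1 + k) + (2 + k) * (1 + k) * (2 + t) ^ k
    ≡⟨ solve₃ ((3 + t) ^ (2 + k)) (2 + k) (1 + k) ((2 + t) ^ (1 + k)) ((2 + t) ^ k) ⟩
  (3 + t) ^ (2 + k) + (2 + k) * ((2 + t) ^ (1 + k) + (1 + k) * (2 + t) ^ k)
    ≤⟨ ℕP.+-monoʳ-≤ ((3 + t) ^ (2 + k)) (ℕP.*-monoʳ-≤ (2 + k) (binomial-lower (2 + t) k)) ⟩
  (3 + t) ^ (2 + k) + (2 + k) * (3 + t) ^ (1 + k)
    ≤⟨ binomial-lower (3 + t) (1 + k) ⟩
  (4 + t) ^ (2 + k)
    ≡⟨ cong (_^ (2 + k)) (sym (solve₄ r k)) ⟩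
  (suc r + 2 * (2 + k)) ^ (2 + k)
    ∎
  where
  open ℕP.≤-Reasoning
  t : ℕ
  t = suc r + 2 * k
  solve : ∀ a b c x y z → a * (b * c) * (x + y + z) ≡ a * (b * c) * x + a * (b * c * y) + a * b * (c * z)
  solve = ℕSolver.solve-∀
  solve₁ : ∀ r k → r + 2 * (2 + k) ≡ 3 + ((1 + r) + 2 * k)
  solve₁ = ℕSolver.solve-∀
  solve₂ : ∀ r k → (1 + r) + 2 * (1 + k) ≡ 2 + ((1 + r) + 2 * k)
  solve₂ = ℕSolver.solve-∀
  solve₃ : ∀ A a b B C → A + a * B + a * b * C ≡ A + a * (B + b * C)
  solve₃ = ℕSolver.solve-∀
  solve₄ : ∀ r k → (1 + r) + 2 * (2 + k) ≡ 4 + ((1 + r) + 2 * k)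
  solve₄ = ℕSolver.solve-∀

r^k≤k!*F : ∀ k r → r ^ k ≤ k ! * F r k
r^k≤k!*F zero    r = ℕP.≤-reflexive (sym (trans (ℕP.*-identityˡ (F r 0)) (F-zero r)))
r^k≤k!*F (suc k) zero = z≤n
r^k≤k!*F (suc k) (suc r) = begin
  suc r ^ suc k                                   ≡⟨ cong (_^ suc k) (ℕP.+-comm 1 r) ⟩
  (r + 1) ^ suc k                                 ≤⟨ binomial-upper r 1 k ⟩
  r ^ suc k + suc k * 1 * (r + 1) ^ k             ≡⟨ cong₂ (λ a b → r ^ suc k + a * b ^ k) (ℕP.*-identityʳ (suc k)) (ℕP.+-comm r 1) ⟩
  r ^ suc k + suc k * suc r ^ k                   ≤⟨ ℕP.+-mono-≤ (r^k≤k!*F (suc k) r) (ℕP.*-monoʳ-≤ (suc k) (r^k≤k!*F k (suc r))) ⟩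
  suc k ! * F r (suc k) + suc k * (k ! * F (suc r) k) ≡⟨ solve (suc k) (k !) (F r (suc k)) (F (suc r) k) ⟩
  suc k ! * (F r (suc k) + F (suc r) k)           ≤⟨ ℕP.*-monoʳ-≤ (suc k !) (F-recurrence-≤ r k) ⟩
  suc k ! * F (suc r) (suc k)                     ∎
  where
  open ℕP.≤-Reasoning
  solve : ∀ a b x y → a * b * x + a * (b * y) ≡ a * b * (x + y)
  solve = ℕSolver.solve-∀

*-distribʳ-^ : ∀ a b n → (a * b) ^ n ≡ a ^ n * b ^ n
*-distribʳ-^ a b zero    = refl
*-distribʳ-^ a b (suc n) = trans (cong ((a * b) *_) (*-distribʳ-^ a b n)) (solve a b (a ^ n) (b ^ n))
  where
  solve : ∀ a b x y → a * b * (x * y) ≡ a * x * (b * y)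
  solve = ℕSolver.solve-∀

[r+c]^k≤[1+c]^k*r^k : ∀ r c k → 1 ≤ r → (r + c) ^ k ≤ suc c ^ k * r ^ k
[r+c]^k≤[1+c]^k*r^k r@(suc _) c k _ =
  ℕP.≤-trans (ℕP.^-monoˡ-≤ k (ℕP.+-monoʳ-≤ r (ℕP.m≤m*n c r))) (ℕP.≤-reflexive (*-distribʳ-^ (suc c) r k))

F-errorBound : ℕ → ℕ
F-errorBound k = suc k * (2 * suc k) * suc (2 * suc k) ^ k

[1+k]!*F≤ : ∀ k r → 1 ≤ r → suc k ! * F r (suc k) ≤ r ^ suc k + F-errorBound k * r ^ k
[1+k]!*F≤ k r 1≤r = begin
  suc k ! * F r (suc k)                        ≤⟨ k!*F≤[r+2k]^k (suc k) r ⟩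
  (r + c) ^ suc k                              ≤⟨ binomial-upper r c k ⟩
  r ^ suc k + suc k * c * (r + c) ^ k          ≤⟨ ℕP.+-monoʳ-≤ (r ^ suc k) (ℕP.*-monoʳ-≤ (suc k * c) ([r+c]^k≤[1+c]^k*r^k r c k 1≤r)) ⟩
  r ^ suc k + suc k * c * (suc c ^ k * r ^ k)  ≡⟨ cong (λ x → r ^ suc k + x) (sym (ℕP.*-assoc (suc k * c) (suc c ^ k) (r ^ k))) ⟩
  r ^ suc k + F-errorBound k * r ^ k           ∎
  where
  open ℕP.≤-Reasoning
  c : ℕ
  c = 2 * suc k

F[r/d,j/d]≤ : ∀ r j d → .{{_ : NonZero d}} → 1 ≤ r → 1 ≤ j → 2 ≤ d →
              F (r / d) (j / d) ≤ suc (2 * j) ^ (j ∸ 1) * r ^ (j ∸ 1)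
F[r/d,j/d]≤ r j d 1≤r 1≤j 2≤d = begin
  F (r / d) (j / d)                          ≤⟨ ℕP.m≤n*m (F (r / d) (j / d)) ((j / d) !) {{(j / d) ℕP.!≢0}} ⟩
  (j / d) ! * F (r / d) (j / d)              ≤⟨ k!*F≤[r+2k]^k (j / d) (r / d) ⟩
  (r / d + 2 * (j / d)) ^ (j / d)            ≤⟨ ℕP.^-monoˡ-≤ (j / d) (ℕP.+-mono-≤ (ℕDM.m/n≤m r d) (ℕP.*-monoʳ-≤ 2 (ℕDM.m/n≤m j d))) ⟩
  (r + 2 * j) ^ (j / d)                      ≤⟨ ℕP.^-monoʳ-≤ (r + 2 * j) {{r+2j≢0}} j/d≤j∸1 ⟩
  (r + 2 * j) ^ (j ∸ 1)                      ≤⟨ [r+c]^k≤[1+c]^k*r^k r (2 * j) (j ∸ 1) 1≤r ⟩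
  suc (2 * j) ^ (j ∸ 1) * r ^ (j ∸ 1)        ∎
  where
  open ℕP.≤-Reasoning
  instance
    j≢0 : NonZero j
    j≢0 = ℕ.>-nonZero 1≤j
  r+2j≢0 : NonZero (r + 2 * j)
  r+2j≢0 = ℕ.>-nonZero (ℕP.≤-trans 1≤r (ℕP.m≤m+n r _))
  j/d≤j∸1 : j / d ≤ j ∸ 1
  j/d≤j∸1 = ℕP.≤-pred (ℕP.≤-trans (ℕDM.m/n<m j d 2≤d) (ℕP.≤-reflexive (sym (ℕP.suc-pred j))))

-- H as a sum over the divisors of j

sign : ℕ → ℕ → ℤ
sign r d = if does (2 ∣? d) then negOnePow (r / 2) else + 1

sign-twist : ∀ r d → .{{_ : NonZero d}} → d ∣ r → negOnePow r ℤ.* (μ d ℤ.* negOnePow (r / d)) ≡ sign r d ℤ.* μ d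
sign-twist r d (divides q refl) with parityView d
... | odd e = begin
  negOnePow (q * d) ℤ.* (μ d ℤ.* negOnePow (q * d / d)) ≡⟨ cong₂ (λ a b → a ℤ.* (μ d ℤ.* negOnePow b)) (negOnePow-*odd q e) (ℕDM.m*n/n≡m q d) ⟩
  negOnePow q ℤ.* (μ d ℤ.* negOnePow q)                 ≡⟨ cancel-square (negOnePow q) (μ d) (negOnePow-square q) ⟩
  μ d                                                   ≡⟨ sym (ℤP.*-identityˡ (μ d)) ⟩
  + 1 ℤ.* μ d                                           ≡⟨ cong (λ b → (if b then negOnePow (q * d / 2) else + 1) ℤ.* μ d) (sym (dec-false (2 ∣? d) (2∤odd e))) ⟩
  sign (q * d) d ℤ.* μ d                                ∎
  where
  open ≡-Reasoning
  cancel-square : ∀ s x → s ℤ.* s ≡ + 1 → s ℤ.* (x ℤ.* s) ≡ x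
  cancel-square s x s²≡1 = trans (lemma s x) (trans (cong (ℤ._* x) s²≡1) (ℤP.*-identityˡ x))
    where
    lemma : ∀ s x → s ℤ.* (x ℤ.* s) ≡ s ℤ.* s ℤ.* x
    lemma = solve-∀
... | even e with parityView e
...   | even f = trans (cong (λ m → negOnePow (q * d) ℤ.* (m ℤ.* negOnePow (q * d / d))) μd≡0)
                       (trans (ℤP.*-zeroʳ (negOnePow (q * d))) (trans (sym (ℤP.*-zeroʳ (sign (q * d) d)))
                              (cong (sign (q * d) d ℤ.*_) (sym μd≡0))))
  where
  μd≡0 : μ d ≡ + 0
  μd≡0 = μ-squareFactor d (2 , s≤s (s≤s z≤n) , divides f (trans (sym (ℕP.*-assoc 2 2 f)) (ℕP.*-comm 4 f)))
...   | odd f = begin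
  negOnePow (q * d) ℤ.* (μ d ℤ.* negOnePow (q * d / d)) ≡⟨ cong₂ (λ a b → a ℤ.* (μ d ℤ.* negOnePow b)) even-power (ℕDM.m*n/n≡m q d) ⟩
  + 1 ℤ.* (μ d ℤ.* negOnePow q)                         ≡⟨ trans (ℤP.*-identityˡ _) (ℤP.*-comm (μ d) (negOnePow q)) ⟩
  negOnePow q ℤ.* μ d                                   ≡⟨ cong (ℤ._* μ d) (sym (trans (cong negOnePow half) (negOnePow-*odd q f))) ⟩
  negOnePow (q * d / 2) ℤ.* μ d                         ≡⟨ cong (λ b → (if b then negOnePow (q * d / 2) else + 1) ℤ.* μ d) (sym (dec-true (2 ∣? d) (2∣even e))) ⟩
  sign (q * d) d ℤ.* μ d                                ∎
  where
  open ≡-Reasoning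
  q*d≡2*[q*e] : q * d ≡ 2 * (q * e)
  q*d≡2*[q*e] = solve q e
    where
    solve : ∀ q e → q * (2 * e) ≡ 2 * (q * e)
    solve = ℕSolver.solve-∀
  even-power : negOnePow (q * d) ≡ + 1
  even-power = trans (cong negOnePow q*d≡2*[q*e]) (negOnePow-even (q * e))
  half : q * d / 2 ≡ q * e
  half = trans (cong (_/ 2) (trans q*d≡2*[q*e] (ℕP.*-comm 2 (q * e)))) (ℕDM.m*n/n≡m (q * e) 2)

-- r times the summand of the general formula for the divisor d (Defs.generalTerm).
twistedTerm : ℕ → ℕ → (d : ℕ) → .{{NonZero d}} → ℤ
twistedTerm r j d = if does (d ∣? r) then sign r d ℤ.* μ d ℤ.* + F (r / d) (j / d) else + 0

twistedTerm-∣ : ∀ r j d → .{{_ : NonZero d}} → d ∣ r → twistedTerm r j d ≡ sign r d ℤ.* μ d ℤ.* + F (r / d) (j / d)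
twistedTerm-∣ r j d d∣r = cong (λ b → if b then sign r d ℤ.* μ d ℤ.* + F (r / d) (j / d) else + 0) (dec-true (d ∣? r) d∣r)

twistedTerm≡sign*μ*χ : ∀ r j d → .{{_ : NonZero d}} →
  twistedTerm r j d ≡ sign r d ℤ.* μ d ℤ.* (χ r d ℤ.* + F (r / d) (j / d))
twistedTerm≡sign*μ*χ r j d with d ∣? r
... | yes _ = cong (sign r d ℤ.* μ d ℤ.*_) (sym (ℤP.*-identityˡ _))
... | no _  = sym (ℤP.*-zeroʳ (sign r d ℤ.* μ d))

twistedTerm-one : ∀ r j → twistedTerm r j 1 ≡ + F r j
twistedTerm-one r j = begin
  twistedTerm r j 1                  ≡⟨ twistedTerm-∣ r j 1 (ℕD.1∣ r) ⟩
  + 1 ℤ.* + F (r / 1) (j / 1)        ≡⟨ ℤP.*-identityˡ _ ⟩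
  + F (r / 1) (j / 1)                ≡⟨ cong₂ (λ a b → + F a b) (ℕDM.n/1≡n r) (ℕDM.n/1≡n j) ⟩
  + F r j                            ∎
  where open ≡-Reasoning

gcd≢0 : ∀ r j → .{{NonZero r}} → NonZero (gcd r j)
gcd≢0 r j = ℕ.≢-nonZero (λ g≡0 → ℕ.≢-nonZero⁻¹ r (ℕD.0∣⇒≡0 (subst (_∣ r) g≡0 (gcd[m,n]∣m r j))))

negOnePow*sumDivℤ : ∀ r j → .{{_ : NonZero r}} → 1 ≤ j →
  negOnePow r ℤ.* sumDivℤ (gcd r j) (λ d → μ d ℤ.* negOnePow (r / d) ℤ.* + F (r / d) (j / d))
    ≡ sumDivℤ j (twistedTerm r j)
negOnePow*sumDivℤ r j 1≤j = begin
  negOnePow r ℤ.* sumDivℤ g f                    ≡⟨ cong (negOnePow r ℤ.*_) (sumDivℤ≡∑ g f) ⟩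
  negOnePow r ℤ.* Σℤ.∑ g [∣g]f                   ≡⟨ ∑-homo ℤP.+-0-commutativeMonoid ℤP.+-0-commutativeMonoid
                                                       (negOnePow r ℤ.*_) (ℤP.*-distribˡ-+ (negOnePow r)) (ℤP.*-zeroʳ (negOnePow r)) g [∣g]f ⟩
  Σℤ.∑ g (λ k → negOnePow r ℤ.* [∣g]f k)         ≡⟨ sym (Σℤ.∑-truncate g≤j beyond-gcd) ⟩
  Σℤ.∑ j (λ k → negOnePow r ℤ.* [∣g]f k)         ≡⟨ Σℤ.∑-cong j (λ k _ → termwise (suc k)) ⟩
  Σℤ.∑ j (λ k → if does (suc k ∣? j) then twistedTerm r j (suc k) else + 0) ≡⟨ sym (sumDivℤ≡∑ j (twistedTerm r j)) ⟩
  sumDivℤ j (twistedTerm r j)                    ∎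
  where
  open ≡-Reasoning
  g : ℕ
  g = gcd r j
  instance
    j≢0 : NonZero j
    j≢0 = ℕ.>-nonZero 1≤j
    g≢0 : NonZero g
    g≢0 = gcd≢0 r j
  f : (d : ℕ) → .{{NonZero d}} → ℤ
  f d = μ d ℤ.* negOnePow (r / d) ℤ.* + F (r / d) (j / d)
  [∣g]f : ℕ → ℤ
  [∣g]f k = if does (suc k ∣? g) then f (suc k) else + 0
  g≤j : g ≤ j
  g≤j = ∣⇒≤ (gcd[m,n]∣n r j)
  beyond-gcd : ∀ k → g ≤ k → k < j → negOnePow r ℤ.* [∣g]f k ≡ + 0
  beyond-gcd k g≤k _ = trans (cong (λ b → negOnePow r ℤ.* (if b then f (suc k) else + 0))
                                   (dec-false (suc k ∣? g) (λ d∣g → ℕP.<⇒≱ (s≤s g≤k) (∣⇒≤ d∣g))))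
                             (ℤP.*-zeroʳ (negOnePow r))
  twist : ∀ d → .{{_ : NonZero d}} → d ∣ r → negOnePow r ℤ.* f d ≡ sign r d ℤ.* μ d ℤ.* + F (r / d) (j / d)
  twist d d∣r = begin
    negOnePow r ℤ.* (μ d ℤ.* negOnePow (r / d) ℤ.* + F (r / d) (j / d))   ≡⟨ sym (ℤP.*-assoc (negOnePow r) _ _) ⟩
    negOnePow r ℤ.* (μ d ℤ.* negOnePow (r / d)) ℤ.* + F (r / d) (j / d)   ≡⟨ cong (ℤ._* + F (r / d) (j / d)) (sign-twist r d d∣r) ⟩
    sign r d ℤ.* μ d ℤ.* + F (r / d) (j / d)                              ∎
  termwise : ∀ d → .{{_ : NonZero d}} →
    negOnePow r ℤ.* (if does (d ∣? g) then f d else + 0) ≡ (if does (d ∣? j) then twistedTerm r j d else + 0)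
  termwise d with d ∣? j | d ∣? r
  ... | yes d∣j | yes d∣r = trans (cong (λ b → negOnePow r ℤ.* (if b then f d else + 0))
                                        (dec-true (d ∣? g) (gcd-greatest d∣r d∣j)))
                                  (twist d d∣r)
  ... | yes _   | no d∤r  = trans (cong (λ b → negOnePow r ℤ.* (if b then f d else + 0))
                                        (dec-false (d ∣? g) (λ d∣g → d∤r (∣-trans d∣g (gcd[m,n]∣m r j)))))
                                  (ℤP.*-zeroʳ (negOnePow r))
  ... | no d∤j  | _       = trans (cong (λ b → negOnePow r ℤ.* (if b then f d else + 0))
                                        (dec-false (d ∣? g) (λ d∣g → d∤j (∣-trans d∣g (gcd[m,n]∣n r j)))))
                                  (ℤP.*-zeroʳ (negOnePow r))

H≡sumDivℤ/r : ∀ r j → .{{_ : NonZero r}} → 1 ≤ j → H r j ≡ sumDivℤ j (twistedTerm r j) ℚ./ r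
H≡sumDivℤ/r r j 1≤j = cong (λ z → z ℚ./ r) (negOnePow*sumDivℤ r j 1≤j)

twistedTerm/r≡generalTerm : ∀ r j d → .{{_ : NonZero r}} → .{{_ : NonZero d}} →
  twistedTerm r j d ℚ./ r ≡ generalTerm r j d
twistedTerm/r≡generalTerm r j d with d ∣? r
... | no _  = ℚP.0/n≡0 r
... | yes _ = /-≡ (s ℤ.* μ d ℤ.* + Fd) (s ℤ.* μ d ℤ.* + (f * Fd)) r (r * f)
  (begin
    s ℤ.* μ d ℤ.* + Fd ℤ.* + (r * f)           ≡⟨ cong (s ℤ.* μ d ℤ.* + Fd ℤ.*_) (ℤP.pos-* r f) ⟩
    s ℤ.* μ d ℤ.* + Fd ℤ.* (+ r ℤ.* + f)       ≡⟨ solve s (μ d) (+ Fd) (+ r) (+ f) ⟩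
    s ℤ.* μ d ℤ.* (+ f ℤ.* + Fd) ℤ.* + r       ≡⟨ cong (λ x → s ℤ.* μ d ℤ.* x ℤ.* + r) (sym (ℤP.pos-* f Fd)) ⟩
    s ℤ.* μ d ℤ.* + (f * Fd) ℤ.* + r           ∎)
  where
  open ≡-Reasoning
  s : ℤ
  s = sign r d
  f : ℕ
  f = (j / d) !
  Fd : ℕ
  Fd = F (r / d) (j / d)
  instance
    f≢0 : NonZero f
    f≢0 = (j / d) ℕP.!≢0
    rf≢0 : NonZero (r * f)
    rf≢0 = ℕP.m*n≢0 r f
  solve : ∀ s m F r f → s ℤ.* m ℤ.* F ℤ.* (r ℤ.* f) ≡ s ℤ.* m ℤ.* (f ℤ.* F) ℤ.* r
  solve = solve-∀

general-formula : ∀ r → .{{_ : NonZero r}} → ∀ j → 1 ≤ j → H r j ≡ generalRHS r j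
general-formula r j 1≤j = begin
  H r j                                                              ≡⟨ H≡sumDivℤ/r r j 1≤j ⟩
  sumDivℤ j (twistedTerm r j) ℚ./ r                                  ≡⟨ cong (λ z → z ℚ./ r) (sumDivℤ≡∑ j (twistedTerm r j)) ⟩
  Σℤ.∑ j [∣j]t ℚ./ r                                                ≡⟨ ∑-homo ℤP.+-0-commutativeMonoid ℚP.+-0-commutativeMonoid
                                                                          (λ z → z ℚ./ r) (λ a b → /-distrib-+ a b r) (ℚP.0/n≡0 r) j [∣j]t ⟩
  Σℚ.∑ j (λ k → [∣j]t k ℚ./ r)                                      ≡⟨ Σℚ.∑-cong j (λ k _ → termwise (suc k)) ⟩
  Σℚ.∑ j (λ k → oddPart (suc k) ℚ.+ evenPart (suc k))               ≡⟨ Σℚ.∑-distrib j (λ k → oddPart (suc k)) (λ k → evenPart (suc k)) ⟩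
  Σℚ.∑ j (λ k → oddPart (suc k)) ℚ.+ Σℚ.∑ j (λ k → evenPart (suc k))
    ≡⟨ sym (cong₂ ℚ._+_ (sumDiv≡∑ j (λ d → if does (2 ∣? d) then 0ℚ else generalTerm r j d))
                        (sumDiv≡∑ j (λ d → if does (2 ∣? d) then generalTerm r j d else 0ℚ))) ⟩
  generalRHS r j                                                     ∎
  where
  open ≡-Reasoning
  [∣j]t : ℕ → ℤ
  [∣j]t k = if does (suc k ∣? j) then twistedTerm r j (suc k) else + 0
  oddPart evenPart : (d : ℕ) → .{{NonZero d}} → ℚ
  oddPart d = if does (d ∣? j) then (if does (2 ∣? d) then 0ℚ else generalTerm r j d) else 0ℚ
  evenPart d = if does (d ∣? j) then (if does (2 ∣? d) then generalTerm r j d else 0ℚ) else 0ℚ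
  termwise : ∀ d → .{{_ : NonZero d}} →
    (if does (d ∣? j) then twistedTerm r j d else + 0) ℚ./ r ≡ oddPart d ℚ.+ evenPart d
  termwise d with does (d ∣? j)
  ... | true  = trans (twistedTerm/r≡generalTerm r j d) (Σℚ.if-split (does (2 ∣? d)) (generalTerm r j d))
  ... | false = trans (ℚP.0/n≡0 r) (sym (ℚP.+-identityˡ 0ℚ))

-- The case j = 0

∑∣*negOnePow-expand≡0 : ∀ r → 3 ≤ r → sumDivℤ r (λ d → μ d ℤ.* negOnePow (r / d)) ≡ + 0
∑∣*negOnePow-expand≡0 r 3≤r = begin
  sumDivℤ r (λ d → μ d ℤ.* negOnePow (r / d))               ≡⟨ sumDivℤ≡∑ r (λ d → μ d ℤ.* negOnePow (r / d)) ⟩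
  Σℤ.∑ r (λ k → if does (suc k ∣? r) then μ (suc k) ℤ.* negOnePow (r / suc k) else + 0)
                                                             ≡⟨ Σℤ.∑-cong r (λ k _ → termwise (suc k)) ⟩
  Σℤ.∑ r (λ k → ℤ.- [ suc k ∣ r ]μ ℤ.+ + 2 ℤ.* evenPart (suc k))
                                                             ≡⟨ Σℤ.∑-distrib r (λ k → ℤ.- [ suc k ∣ r ]μ) (λ k → + 2 ℤ.* evenPart (suc k)) ⟩
  Σℤ.∑ r (λ k → ℤ.- [ suc k ∣ r ]μ) ℤ.+ Σℤ.∑ r (λ k → + 2 ℤ.* evenPart (suc k))
                                                             ≡⟨ cong₂ ℤ._+_ (∑-neg r (λ k → [ suc k ∣ r ]μ)) (sym (∑-homo ℤP.+-0-commutativeMonoid ℤP.+-0-commutativeMonoid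
                                                                  (+ 2 ℤ.*_) (ℤP.*-distribˡ-+ (+ 2)) refl r (λ k → evenPart (suc k)))) ⟩
  ℤ.- Σℤ.∑ r (λ k → [ suc k ∣ r ]μ) ℤ.+ + 2 ℤ.* Σℤ.∑ r (λ k → evenPart (suc k))
                                                             ≡⟨ cong₂ (λ a b → ℤ.- a ℤ.+ + 2 ℤ.* b) (trans (sym (sumDivℤ≡∑ r (λ d → μ d))) (∑∣μ≡0 r 2≤r)) ∑evenPart≡0 ⟩
  + 0                                                        ∎
  where
  open ≡-Reasoning
  2≤r : 2 ≤ r
  2≤r = ℕP.≤-trans (ℕP.n≤1+n 2) 3≤r
  [_∣_]μ : ℕ → ℕ → ℤ
  [ d ∣ n ]μ = if does (d ∣? n) then μ d else + 0
  evenPart : (d : ℕ) → .{{NonZero d}} → ℤ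
  evenPart d = if does (d ∣? r) then (if does (2 ∣? (r / d)) then μ d else + 0) else + 0
  termwise : ∀ d → .{{_ : NonZero d}} →
    (if does (d ∣? r) then μ d ℤ.* negOnePow (r / d) else + 0) ≡ ℤ.- [ d ∣ r ]μ ℤ.+ + 2 ℤ.* evenPart d
  termwise d with does (d ∣? r)
  ... | true  = *negOnePow-expand (μ d) (r / d)
  ... | false = refl
  evenPart≡ : ∀ e → r ≡ 2 * e → ∀ d → .{{_ : NonZero d}} → evenPart d ≡ [ d ∣ e ]μ
  evenPart≡ e refl d with d ∣? 2 * e | d ∣? e
  ... | no _ | no _ = refl
  ... | no d∤2e | yes d∣e = ⊥-elim (d∤2e (ℕD.∣n⇒∣m*n 2 d∣e))
  ... | yes d∣2e | d∣?e = cong (λ b → if b then μ d else + 0) (does-⇔ (mk⇔ to from) (2 ∣? (2 * e / d)) d∣?e)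
    where
    to : 2 ∣ 2 * e / d → d ∣ e
    to (divides q 2e/d≡q*2) = ℕD.*-cancelˡ-∣ 2 (divides q (begin
      2 * e              ≡⟨ sym (ℕDM.m*[n/m]≡n d∣2e) ⟩
      d * (2 * e / d)    ≡⟨ cong (d *_) 2e/d≡q*2 ⟩
      d * (q * 2)        ≡⟨ solve d q ⟩
      q * (2 * d)        ∎))
      where
      solve : ∀ d q → d * (q * 2) ≡ q * (2 * d)
      solve = ℕSolver.solve-∀
    from : d ∣ e → 2 ∣ 2 * e / d
    from (divides q refl) = divides q (begin
      2 * (q * d) / d    ≡⟨ cong (_/ d) (solve q d) ⟩
      q * 2 * d / d      ≡⟨ ℕDM.m*n/n≡m (q * 2) d ⟩
      q * 2              ∎)
      where
      solve : ∀ q d → 2 * (q * d) ≡ q * 2 * d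
      solve = ℕSolver.solve-∀
  ∑evenPart≡0 : Σℤ.∑ r (λ k → evenPart (suc k)) ≡ + 0
  ∑evenPart≡0 with parityView r
  ... | odd e = Σℤ.∑-zero r (λ k _ → noEvenQuotient (suc k))
    where
    noEvenQuotient : ∀ d → .{{_ : NonZero d}} → evenPart d ≡ + 0
    noEvenQuotient d with d ∣? r
    ... | no _ = refl
    ... | yes d∣r = cong (λ b → if b then μ d else + 0)
                         (dec-false (2 ∣? (r / d)) (λ 2∣r/d → 2∤odd e (∣-trans 2∣r/d (divides d (sym (ℕDM.m*[n/m]≡n d∣r))))))
  ... | even e = begin
    Σℤ.∑ r (λ k → evenPart (suc k))      ≡⟨ Σℤ.∑-cong r (λ k _ → evenPart≡ e refl (suc k)) ⟩
    Σℤ.∑ r (λ k → [ suc k ∣ e ]μ)         ≡⟨ Σℤ.∑-truncate e≤r (λ k e≤k _ → cong (λ b → if b then μ (suc k) else + 0)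
                                                (dec-false (suc k ∣? e) (λ d∣e → ℕP.<⇒≱ (s≤s e≤k) (∣⇒≤ {{e≢0}} d∣e)))) ⟩
    Σℤ.∑ e (λ k → [ suc k ∣ e ]μ)         ≡⟨ sym (sumDivℤ≡∑ e (λ d → μ d)) ⟩
    sumDivℤ e (λ d → μ d)                 ≡⟨ ∑∣μ≡0 e 2≤e ⟩
    + 0                                   ∎
    where
    2≤e : 2 ≤ e
    2≤e = 3≤2*e⇒2≤e e 3≤r
      where
      3≤2*e⇒2≤e : ∀ e → 3 ≤ 2 * e → 2 ≤ e
      3≤2*e⇒2≤e (suc (suc _)) _ = s≤s (s≤s z≤n)
      3≤2*e⇒2≤e (suc zero) (s≤s (s≤s ()))
    e≢0 : NonZero e
    e≢0 = ℕ.>-nonZero (ℕP.≤-trans (s≤s z≤n) 2≤e)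
    e≤r : e ≤ 2 * e
    e≤r = ℕP.m≤n*m e 2

H-0-≤2 : ∀ r → .{{_ : NonZero r}} → r ≤ 2 → H r 0 ≡ 1ℚ
H-0-≤2 1 _ = refl
H-0-≤2 2 _ = refl
H-0-≤2 (suc (suc (suc _))) (s≤s (s≤s ()))

H-0->2 : ∀ r → .{{_ : NonZero r}} → 2 < r → H r 0 ≡ 0ℚ
H-0->2 r 2<r = begin
  H r 0                          ≡⟨ cong (λ z → (negOnePow r ℤ.* z) ℚ./ r) sum≡0 ⟩
  (negOnePow r ℤ.* + 0) ℚ./ r    ≡⟨ cong (λ z → z ℚ./ r) (ℤP.*-zeroʳ (negOnePow r)) ⟩
  + 0 ℚ./ r                      ≡⟨ ℚP.0/n≡0 r ⟩
  0ℚ                             ∎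
  where
  open ≡-Reasoning
  F[r/d,0]≡1 : ∀ d → .{{_ : NonZero d}} → μ d ℤ.* negOnePow (r / d) ℤ.* + F (r / d) (0 / d) ≡ μ d ℤ.* negOnePow (r / d)
  F[r/d,0]≡1 d = trans (cong (λ y → μ d ℤ.* negOnePow (r / d) ℤ.* + F (r / d) y) (ℕDM.0/n≡0 d))
                       (trans (cong (λ y → μ d ℤ.* negOnePow (r / d) ℤ.* + y) (F-zero (r / d))) (ℤP.*-identityʳ _))
  sum≡0 : sumDivℤ (gcd r 0) (λ d → μ d ℤ.* negOnePow (r / d) ℤ.* + F (r / d) (0 / d)) ≡ + 0
  sum≡0 = begin
    sumDivℤ (gcd r 0) (λ d → μ d ℤ.* negOnePow (r / d) ℤ.* + F (r / d) (0 / d))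
      ≡⟨ cong (λ g → sumDivℤ g (λ d → μ d ℤ.* negOnePow (r / d) ℤ.* + F (r / d) (0 / d))) (ℕGCD.gcd-identityʳ r) ⟩
    sumDivℤ r (λ d → μ d ℤ.* negOnePow (r / d) ℤ.* + F (r / d) (0 / d))
      ≡⟨ sumDivℤ-cong r F[r/d,0]≡1 ⟩
    sumDivℤ r (λ d → μ d ℤ.* negOnePow (r / d))
      ≡⟨ ∑∣*negOnePow-expand≡0 r 2<r ⟩
    + 0 ∎

-- The cases 1 ≤ j ≤ 5

χ-cong : ∀ r d {x y} → (d ∣ r → x ≡ y) → χ r d ℤ.* x ≡ χ r d ℤ.* y
χ-cong r d x≡y with d ∣? r
... | yes d∣r = cong (+ 1 ℤ.*_) (x≡y d∣r)
... | no _    = refl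

sgnχ2-∣ : ∀ {r} → 2 ∣ r → sgnχ2 r ≡ negOnePow (r / 2)
sgnχ2-∣ {r} 2∣r = cong (λ b → if b then negOnePow (r / 2) else + 0) (dec-true (2 ∣? r) 2∣r)

sgnχ2-∤ : ∀ {r} → ¬ 2 ∣ r → sgnχ2 r ≡ + 0
sgnχ2-∤ {r} 2∤r = cong (λ b → if b then negOnePow (r / 2) else + 0) (dec-false (2 ∣? r) 2∤r)

sgnχ2-cong : ∀ r {x y} → (2 ∣ r → x ≡ y) → sgnχ2 r ℤ.* x ≡ sgnχ2 r ℤ.* y
sgnχ2-cong r {x} {y} x≡y with 2 ∣? r
... | yes 2∣r = begin
  sgnχ2 r ℤ.* x            ≡⟨ cong (ℤ._* x) (sgnχ2-∣ 2∣r) ⟩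
  negOnePow (r / 2) ℤ.* x  ≡⟨ cong (negOnePow (r / 2) ℤ.*_) (x≡y 2∣r) ⟩
  negOnePow (r / 2) ℤ.* y  ≡⟨ cong (ℤ._* y) (sym (sgnχ2-∣ 2∣r)) ⟩
  sgnχ2 r ℤ.* y            ∎
  where open ≡-Reasoning
... | no 2∤r = trans (cong (ℤ._* x) (sgnχ2-∤ 2∤r)) (cong (ℤ._* y) (sym (sgnχ2-∤ 2∤r)))

negOnePow*χ≡sgnχ2 : ∀ r → negOnePow (r / 2) ℤ.* χ r 2 ≡ sgnχ2 r
negOnePow*χ≡sgnχ2 r with 2 ∣? r
... | yes 2∣r = begin
  negOnePow (r / 2) ℤ.* χ r 2  ≡⟨ cong (λ b → negOnePow (r / 2) ℤ.* (if b then + 1 else + 0)) (dec-true (2 ∣? r) 2∣r) ⟩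
  negOnePow (r / 2) ℤ.* + 1    ≡⟨ ℤP.*-identityʳ (negOnePow (r / 2)) ⟩
  negOnePow (r / 2)            ≡⟨ sym (sgnχ2-∣ 2∣r) ⟩
  sgnχ2 r                      ∎
  where open ≡-Reasoning
... | no 2∤r = begin
  negOnePow (r / 2) ℤ.* χ r 2  ≡⟨ cong (λ b → negOnePow (r / 2) ℤ.* (if b then + 1 else + 0)) (dec-false (2 ∣? r) 2∤r) ⟩
  negOnePow (r / 2) ℤ.* + 0    ≡⟨ ℤP.*-zeroʳ (negOnePow (r / 2)) ⟩
  + 0                          ≡⟨ sym (sgnχ2-∤ 2∤r) ⟩
  sgnχ2 r                      ∎
  where open ≡-Reasoning

pos-*-cong : ∀ a b c d → a * b ≡ c * d → + a ℤ.* + b ≡ + c ℤ.* + d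
pos-*-cong a b c d eq = trans (sym (ℤP.pos-* a b)) (trans (cong +_ eq) (ℤP.pos-* c d))

scaled-H : ∀ r j c W → .{{_ : NonZero r}} → 1 ≤ j →
           + c ℤ.* sumDivℤ j (twistedTerm r j) ≡ W ℤ.* + r → (+ c ℚ./ 1) ℚ.* H r j ≡ W ℚ./ 1
scaled-H r j c W 1≤j c*S≡W*r = begin
  (+ c ℚ./ 1) ℚ.* H r j          ≡⟨ cong ((+ c ℚ./ 1) ℚ.*_) (H≡sumDivℤ/r r j 1≤j) ⟩
  (+ c ℚ./ 1) ℚ.* (S ℚ./ r)      ≡⟨ /-*-/ (+ c) S 1 r ⟩
  (+ c ℤ.* S) ℚ./ (1 * r)        ≡⟨ /-≡ (+ c ℤ.* S) W (1 * r) 1 (trans (ℤP.*-identityʳ _) (trans c*S≡W*r (cong (λ n → W ℤ.* + n) (sym (ℕP.*-identityˡ r))))) ⟩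
  W ℚ./ 1                        ∎
  where
  open ≡-Reasoning
  S : ℤ
  S = sumDivℤ j (twistedTerm r j)
  instance
    1*r≢0 : NonZero (1 * r)
    1*r≢0 = ℕP.m*n≢0 1 r

H-1 : ∀ r → .{{_ : NonZero r}} → H r 1 ≡ 1ℚ
H-1 r = begin
  H r 1                             ≡⟨ H≡sumDivℤ/r r 1 (s≤s z≤n) ⟩
  (twistedTerm r 1 1 ℤ.+ + 0) ℚ./ r ≡⟨ cong (λ x → (x ℤ.+ + 0) ℚ./ r) (trans (twistedTerm-one r 1) (cong +_ (F-one r))) ⟩
  (+ r ℤ.+ + 0) ℚ./ r               ≡⟨ /-≡ (+ r ℤ.+ + 0) (+ 1) r 1 (solve (+ r)) ⟩
  + 1 ℚ./ 1                         ∎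
  where
  open ≡-Reasoning
  solve : ∀ r → (r ℤ.+ + 0) ℤ.* + 1 ≡ + 1 ℤ.* r
  solve = solve-∀

H-2 : ∀ r → .{{_ : NonZero r}} → (+ 2 ℚ./ 1) ℚ.* H r 2 ≡ (+ 3 ℤ.+ + r ℤ.- sgnχ2 r) ℚ./ 1
H-2 r = scaled-H r 2 2 (+ 3 ℤ.+ + r ℤ.- sgnχ2 r) (s≤s z≤n) (begin
  + 2 ℤ.* (twistedTerm r 2 1 ℤ.+ (twistedTerm r 2 2 ℤ.+ + 0))
    ≡⟨ cong₂ (λ a b → + 2 ℤ.* (a ℤ.+ (b ℤ.+ + 0))) (twistedTerm-one r 2) (twistedTerm≡sign*μ*χ r 2 2) ⟩
  + 2 ℤ.* (+ F r 2 ℤ.+ (s ℤ.* -[1+ 0 ] ℤ.* (χ r 2 ℤ.* + F (r / 2) 1) ℤ.+ + 0))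
    ≡⟨ solve (+ F r 2) s (χ r 2) (+ F (r / 2) 1) ⟩
  + 2 ℤ.* + F r 2 ℤ.- s ℤ.* χ r 2 ℤ.* (+ 2 ℤ.* + F (r / 2) 1)
    ≡⟨ cong₂ ℤ._-_ (trans (pos-*-cong 2 (F r 2) (3 + r) r (F-two r)) (cong (ℤ._* + r) (ℤP.pos-+ 3 r)))
                   (trans (cong (ℤ._* (+ 2 ℤ.* + F (r / 2) 1)) (negOnePow*χ≡sgnχ2 r))
                          (sgnχ2-cong r (λ 2∣r → trans (sym (ℤP.pos-* 2 (F (r / 2) 1))) (cong +_ (p*F[r/p,1]≡r r 2 2∣r))))) ⟩
  (+ 3 ℤ.+ + r) ℤ.* + r ℤ.- sgnχ2 r ℤ.* + r
    ≡⟨ solve′ (+ 3 ℤ.+ + r) (sgnχ2 r) (+ r) ⟩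
  (+ 3 ℤ.+ + r ℤ.- sgnχ2 r) ℤ.* + r ∎)
  where
  open ≡-Reasoning
  s : ℤ
  s = negOnePow (r / 2)
  solve : ∀ F s c F′ → + 2 ℤ.* (F ℤ.+ (s ℤ.* -[1+ 0 ] ℤ.* (c ℤ.* F′) ℤ.+ + 0)) ≡ + 2 ℤ.* F ℤ.- s ℤ.* c ℤ.* (+ 2 ℤ.* F′)
  solve = solve-∀
  solve′ : ∀ a s r → a ℤ.* r ℤ.- s ℤ.* r ≡ (a ℤ.- s) ℤ.* r
  solve′ = solve-∀

H-3 : ∀ r → .{{_ : NonZero r}} → (+ 6 ℚ./ 1) ℚ.* H r 3 ≡ (+ (8 + 9 * r + r ^ 2) ℤ.- + 2 ℤ.* χ r 3) ℚ./ 1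
H-3 r = scaled-H r 3 6 (+ X ℤ.- + 2 ℤ.* χ r 3) (s≤s z≤n) (begin
  + 6 ℤ.* (twistedTerm r 3 1 ℤ.+ (twistedTerm r 3 3 ℤ.+ + 0))
    ≡⟨ cong₂ (λ a b → + 6 ℤ.* (a ℤ.+ (b ℤ.+ + 0))) (twistedTerm-one r 3) (twistedTerm≡sign*μ*χ r 3 3) ⟩
  + 6 ℤ.* (+ F r 3 ℤ.+ (+ 1 ℤ.* -[1+ 0 ] ℤ.* (χ r 3 ℤ.* + F (r / 3) 1) ℤ.+ + 0))
    ≡⟨ solve (+ F r 3) (χ r 3) (+ F (r / 3) 1) ⟩
  + 6 ℤ.* + F r 3 ℤ.- + 2 ℤ.* (χ r 3 ℤ.* (+ 3 ℤ.* + F (r / 3) 1))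
    ≡⟨ cong₂ (λ a b → a ℤ.- + 2 ℤ.* b) (pos-*-cong 6 (F r 3) X r (F-three r))
             (χ-cong r 3 (λ 3∣r → trans (sym (ℤP.pos-* 3 (F (r / 3) 1))) (cong +_ (p*F[r/p,1]≡r r 3 3∣r)))) ⟩
  + X ℤ.* + r ℤ.- + 2 ℤ.* (χ r 3 ℤ.* + r)
    ≡⟨ solve′ (+ X) (χ r 3) (+ r) ⟩
  (+ X ℤ.- + 2 ℤ.* χ r 3) ℤ.* + r ∎)
  where
  open ≡-Reasoning
  X : ℕ
  X = 8 + 9 * r + r ^ 2
  solve : ∀ F c F′ → + 6 ℤ.* (F ℤ.+ (+ 1 ℤ.* -[1+ 0 ] ℤ.* (c ℤ.* F′) ℤ.+ + 0)) ≡ + 6 ℤ.* F ℤ.- + 2 ℤ.* (c ℤ.* (+ 3 ℤ.* F′))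
  solve = solve-∀
  solve′ : ∀ x c r → x ℤ.* r ℤ.- + 2 ℤ.* (c ℤ.* r) ≡ (x ℤ.- + 2 ℤ.* c) ℤ.* r
  solve′ = solve-∀

H-4 : ∀ r → .{{_ : NonZero r}} →
      (+ 24 ℚ./ 1) ℚ.* H r 4 ≡ (+ (42 + 59 * r + 18 * r ^ 2 + r ^ 3) ℤ.- + (18 + 3 * r) ℤ.* sgnχ2 r) ℚ./ 1
H-4 r = scaled-H r 4 24 (+ X ℤ.- + Y ℤ.* sgnχ2 r) (s≤s z≤n) (begin
  + 24 ℤ.* (twistedTerm r 4 1 ℤ.+ (twistedTerm r 4 2 ℤ.+ (twistedTerm r 4 4 ℤ.+ + 0)))
    ≡⟨ cong₃ (λ a b c → + 24 ℤ.* (a ℤ.+ (b ℤ.+ (c ℤ.+ + 0))))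
             (twistedTerm-one r 4) (twistedTerm≡sign*μ*χ r 4 2) (twistedTerm≡sign*μ*χ r 4 4) ⟩
  + 24 ℤ.* (+ F r 4 ℤ.+ (s ℤ.* -[1+ 0 ] ℤ.* (χ r 2 ℤ.* + F (r / 2) 2) ℤ.+ (sign r 4 ℤ.* + 0 ℤ.* (χ r 4 ℤ.* + F (r / 4) 1) ℤ.+ + 0)))
    ≡⟨ solve (+ F r 4) s (χ r 2) (+ F (r / 2) 2) (sign r 4) (χ r 4 ℤ.* + F (r / 4) 1) ⟩
  + 24 ℤ.* + F r 4 ℤ.- s ℤ.* χ r 2 ℤ.* (+ 24 ℤ.* + F (r / 2) 2)
    ≡⟨ cong₂ ℤ._-_ (pos-*-cong 24 (F r 4) X r (F-four r))
                   (trans (cong (ℤ._* (+ 24 ℤ.* + F (r / 2) 2)) (negOnePow*χ≡sgnχ2 r))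
                          (sgnχ2-cong r (λ 2∣r → pos-*-cong 24 (F (r / 2) 2) Y r (24*F[r/2,2]≡[18+3r]*r r 2∣r)))) ⟩
  + X ℤ.* + r ℤ.- sgnχ2 r ℤ.* (+ Y ℤ.* + r)
    ≡⟨ solve′ (+ X) (+ Y) (sgnχ2 r) (+ r) ⟩
  (+ X ℤ.- + Y ℤ.* sgnχ2 r) ℤ.* + r ∎)
  where
  open ≡-Reasoning
  X : ℕ
  X = 42 + 59 * r + 18 * r ^ 2 + r ^ 3
  Y : ℕ
  Y = 18 + 3 * r
  s : ℤ
  s = negOnePow (r / 2)
  solve : ∀ F s c F′ t u → + 24 ℤ.* (F ℤ.+ (s ℤ.* -[1+ 0 ] ℤ.* (c ℤ.* F′) ℤ.+ (t ℤ.* + 0 ℤ.* u ℤ.+ + 0)))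
                           ≡ + 24 ℤ.* F ℤ.- s ℤ.* c ℤ.* (+ 24 ℤ.* F′)
  solve = solve-∀
  solve′ : ∀ x y s r → x ℤ.* r ℤ.- s ℤ.* (y ℤ.* r) ≡ (x ℤ.- y ℤ.* s) ℤ.* r
  solve′ = solve-∀

H-5 : ∀ r → .{{_ : NonZero r}} →
      (+ 120 ℚ./ 1) ℚ.* H r 5 ≡ (+ (264 + 450 * r + 215 * r ^ 2 + 30 * r ^ 3 + r ^ 4) ℤ.- + 24 ℤ.* χ r 5) ℚ./ 1
H-5 r = scaled-H r 5 120 (+ X ℤ.- + 24 ℤ.* χ r 5) (s≤s z≤n) (begin
  + 120 ℤ.* (twistedTerm r 5 1 ℤ.+ (twistedTerm r 5 5 ℤ.+ + 0))
    ≡⟨ cong₂ (λ a b → + 120 ℤ.* (a ℤ.+ (b ℤ.+ + 0))) (twistedTerm-one r 5) (twistedTerm≡sign*μ*χ r 5 5) ⟩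
  + 120 ℤ.* (+ F r 5 ℤ.+ (+ 1 ℤ.* -[1+ 0 ] ℤ.* (χ r 5 ℤ.* + F (r / 5) 1) ℤ.+ + 0))
    ≡⟨ solve (+ F r 5) (χ r 5) (+ F (r / 5) 1) ⟩
  + 120 ℤ.* + F r 5 ℤ.- + 24 ℤ.* (χ r 5 ℤ.* (+ 5 ℤ.* + F (r / 5) 1))
    ≡⟨ cong₂ (λ a b → a ℤ.- + 24 ℤ.* b) (pos-*-cong 120 (F r 5) X r (F-five r))
             (χ-cong r 5 (λ 5∣r → trans (sym (ℤP.pos-* 5 (F (r / 5) 1))) (cong +_ (p*F[r/p,1]≡r r 5 5∣r)))) ⟩
  + X ℤ.* + r ℤ.- + 24 ℤ.* (χ r 5 ℤ.* + r)
    ≡⟨ solve′ (+ X) (χ r 5) (+ r) ⟩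
  (+ X ℤ.- + 24 ℤ.* χ r 5) ℤ.* + r ∎)
  where
  open ≡-Reasoning
  X : ℕ
  X = 264 + 450 * r + 215 * r ^ 2 + 30 * r ^ 3 + r ^ 4
  solve : ∀ F c F′ → + 120 ℤ.* (F ℤ.+ (+ 1 ℤ.* -[1+ 0 ] ℤ.* (c ℤ.* F′) ℤ.+ + 0)) ≡ + 120 ℤ.* F ℤ.- + 24 ℤ.* (c ℤ.* (+ 5 ℤ.* F′))
  solve = solve-∀
  solve′ : ∀ x c r → x ℤ.* r ℤ.- + 24 ℤ.* (c ℤ.* r) ≡ (x ℤ.- + 24 ℤ.* c) ℤ.* r
  solve′ = solve-∀

-- Asymptotics

∣sign∣≤1 : ∀ r d → ℤ.∣ sign r d ∣ ≤ 1
∣sign∣≤1 r d = bound (does (2 ∣? d))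
  where
  bound : ∀ b → ℤ.∣ (if b then negOnePow (r / 2) else + 1) ∣ ≤ 1
  bound true  = ℕP.≤-reflexive (∣negOnePow∣≡1 (r / 2))
  bound false = ℕP.≤-refl

∣χ∣≤1 : ∀ r d → ℤ.∣ χ r d ∣ ≤ 1
∣χ∣≤1 r d = bound (does (d ∣? r))
  where
  bound : ∀ b → ℤ.∣ (if b then + 1 else + 0) ∣ ≤ 1
  bound true  = ℕP.≤-refl
  bound false = z≤n

∣twistedTerm∣≤F : ∀ r j d → .{{_ : NonZero d}} → ℤ.∣ twistedTerm r j d ∣ ≤ F (r / d) (j / d)
∣twistedTerm∣≤F r j d = begin
  ℤ.∣ twistedTerm r j d ∣                                   ≡⟨ cong ℤ.∣_∣ (twistedTerm≡sign*μ*χ r j d) ⟩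
  ℤ.∣ sign r d ℤ.* μ d ℤ.* (χ r d ℤ.* + Fd) ∣              ≡⟨ trans (ℤP.abs-* (sign r d ℤ.* μ d) _)
                                                                  (cong₂ _*_ (ℤP.abs-* (sign r d) (μ d)) (ℤP.abs-* (χ r d) (+ Fd))) ⟩
  ℤ.∣ sign r d ∣ * ℤ.∣ μ d ∣ * (ℤ.∣ χ r d ∣ * Fd)           ≤⟨ ℕP.*-mono-≤ (ℕP.*-mono-≤ (∣sign∣≤1 r d) (∣μ∣≤1 d)) (ℕP.*-monoˡ-≤ Fd (∣χ∣≤1 r d)) ⟩
  1 * 1 * (1 * Fd)                                          ≡⟨ ℕP.*-identityˡ (1 * Fd) ⟩
  1 * Fd                                                    ≡⟨ ℕP.*-identityˡ Fd ⟩
  Fd                                                        ∎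
  where
  open ℕP.≤-Reasoning
  Fd : ℕ
  Fd = F (r / d) (j / d)

∣∑∣≤ : ∀ n f B → (∀ k → k < n → ℤ.∣ f k ∣ ≤ B) → ℤ.∣ Σℤ.∑ n f ∣ ≤ n * B
∣∑∣≤ zero    f B ∣f∣≤B = z≤n
∣∑∣≤ (suc n) f B ∣f∣≤B = ℕP.≤-trans (ℤP.∣i+j∣≤∣i∣+∣j∣ (f 0) (Σℤ.∑ n (f ∘ suc)))
  (ℕP.+-mono-≤ (∣f∣≤B 0 (s≤s z≤n)) (∣∑∣≤ n (f ∘ suc) B (λ k k<n → ∣f∣≤B (suc k) (s≤s k<n))))

∣P-Q∣≤ : ∀ P Q d → Q ≤ P → P ≤ Q + d → ℤ.∣ + P ℤ.- + Q ∣ ≤ d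
∣P-Q∣≤ P Q d Q≤P P≤Q+d = begin
  ℤ.∣ + P ℤ.- + Q ∣  ≡⟨ cong ℤ.∣_∣ (trans (ℤP.[+m]-[+n]≡m⊖n P Q) (ℤP.⊖-≥ Q≤P)) ⟩
  P ∸ Q              ≤⟨ ℕP.∸-monoˡ-≤ Q P≤Q+d ⟩
  Q + d ∸ Q          ≡⟨ ℕP.m+n∸m≡n Q d ⟩
  d                  ∎
  where open ℕP.≤-Reasoning

sumDivℤ≡F+rest : ∀ r j → .{{_ : NonZero r}} →
  sumDivℤ (suc j) (twistedTerm r (suc j))
    ≡ + F r (suc j) ℤ.+ Σℤ.∑ j (λ k → if does (2 + k ∣? suc j) then twistedTerm r (suc j) (2 + k) else + 0)
sumDivℤ≡F+rest r j = trans (sumDivℤ≡∑ (suc j) (twistedTerm r (suc j)))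
  (cong (ℤ._+ Σℤ.∑ j (λ k → if does (2 + k ∣? suc j) then twistedTerm r (suc j) (2 + k) else + 0)) (trans (cong (λ b → if b then twistedTerm r (suc j) 1 else + 0) (dec-true (1 ∣? suc j) (ℕD.1∣ suc j)))
                        (twistedTerm-one r (suc j))))

module Asymptotics (t : ℕ) where

  -- B bounds the terms of the divisors d ≥ 2 and K collects the three error sources:
  -- j! F(r, j) - r^j, those terms, and the second-order term 3 r^(j-2) / (2 (j-2)!).

  j f₁ f₂ B K : ℕ
  j  = 3 + t
  f₁ = j !
  f₂ = (1 + t) !
  B  = suc (2 * j) ^ (2 + t)
  K  = F-errorBound (2 + t) + f₁ * (2 + t) * B + 3

  instance
    f₁≢0 : NonZero f₁
    f₁≢0 = j ℕP.!≢0
    f₂≢0 : NonZero f₂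
    f₂≢0 = (1 + t) ℕP.!≢0
    2f₂≢0 : NonZero (2 * f₂)
    2f₂≢0 = ℕP.m*n≢0 2 f₂

  module _ (r : ℕ) .{{_ : NonZero r}} (1≤r : 1 ≤ r) where

    D : ℕ
    D = r * f₁ * (2 * f₂)

    instance
      rf₁≢0 : NonZero (r * f₁)
      rf₁≢0 = ℕP.m*n≢0 r f₁
      D≢0 : NonZero D
      D≢0 = ℕP.m*n≢0 (r * f₁) (2 * f₂)

    rest a b E N : ℤ
    rest = Σℤ.∑ (2 + t) (λ k → if does (2 + k ∣? j) then twistedTerm r j (2 + k) else + 0)
    a = + (r ^ (2 + t))
    b = + (3 * r ^ (1 + t))
    E = + (f₁ * F r j) ℤ.- + (r ^ j)
    N = (E ℤ.+ + f₁ ℤ.* rest) ℤ.* + (2 * f₂) ℤ.- b ℤ.* + (r * f₁)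

    deviation≡N/D : H r j ℚ.- (a ℚ./ f₁) ℚ.- (+ 1 ℚ./ 2) ℚ.* (b ℚ./ f₂) ≡ N ℚ./ D
    deviation≡N/D = begin
      H r j ℚ.+ ℚ.- (a ℚ./ f₁) ℚ.+ ℚ.- ((+ 1 ℚ./ 2) ℚ.* (b ℚ./ f₂))
        ≡⟨ cong₂ (λ x y → x ℚ.+ ℚ.- (a ℚ./ f₁) ℚ.+ ℚ.- y) (H≡sumDivℤ/r r j (s≤s z≤n)) (/-*-/ (+ 1) b 2 f₂) ⟩
      S ℚ./ r ℚ.+ ℚ.- (a ℚ./ f₁) ℚ.+ ℚ.- ((+ 1 ℤ.* b) ℚ./ (2 * f₂))
        ≡⟨ cong₂ (λ x y → S ℚ./ r ℚ.+ x ℚ.+ y) (-‿/ a f₁) (-‿/ (+ 1 ℤ.* b) (2 * f₂)) ⟩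
      S ℚ./ r ℚ.+ (ℤ.- a) ℚ./ f₁ ℚ.+ (ℤ.- (+ 1 ℤ.* b)) ℚ./ (2 * f₂)
        ≡⟨ cong (ℚ._+ (ℤ.- (+ 1 ℤ.* b)) ℚ./ (2 * f₂)) (/-+-/ S (ℤ.- a) r f₁) ⟩
      (S ℤ.* + f₁ ℤ.+ ℤ.- a ℤ.* + r) ℚ./ (r * f₁) ℚ.+ (ℤ.- (+ 1 ℤ.* b)) ℚ./ (2 * f₂)
        ≡⟨ /-+-/ (S ℤ.* + f₁ ℤ.+ ℤ.- a ℤ.* + r) (ℤ.- (+ 1 ℤ.* b)) (r * f₁) (2 * f₂) ⟩
      ((S ℤ.* + f₁ ℤ.+ ℤ.- a ℤ.* + r) ℤ.* + (2 * f₂) ℤ.+ ℤ.- (+ 1 ℤ.* b) ℤ.* + (r * f₁)) ℚ./ D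
        ≡⟨ cong (ℚ._/ D) numerator≡N ⟩
      N ℚ./ D
        ∎
      where
      open ≡-Reasoning
      S : ℤ
      S = sumDivℤ j (twistedTerm r j)
      ar≡rʲ : a ℤ.* + r ≡ + (r ^ j)
      ar≡rʲ = trans (sym (ℤP.pos-* (r ^ (2 + t)) r)) (cong +_ (ℕP.*-comm (r ^ (2 + t)) r))
      solve : ∀ F R f a b g h → ((F ℤ.+ R) ℤ.* f ℤ.+ ℤ.- a ℤ.* g) ℤ.* h ℤ.+ ℤ.- (+ 1 ℤ.* b) ℤ.* (g ℤ.* f)
                              ≡ (f ℤ.* F ℤ.- a ℤ.* g ℤ.+ f ℤ.* R) ℤ.* h ℤ.- b ℤ.* (g ℤ.* f)
      solve = solve-∀
      numerator≡N : (S ℤ.* + f₁ ℤ.+ ℤ.- a ℤ.* + r) ℤ.* + (2 * f₂) ℤ.+ ℤ.- (+ 1 ℤ.* b) ℤ.* + (r * f₁) ≡ N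
      numerator≡N = begin
        (S ℤ.* + f₁ ℤ.+ ℤ.- a ℤ.* + r) ℤ.* + (2 * f₂) ℤ.+ ℤ.- (+ 1 ℤ.* b) ℤ.* + (r * f₁)
          ≡⟨ cong₂ (λ x y → (x ℤ.* + f₁ ℤ.+ ℤ.- a ℤ.* + r) ℤ.* + (2 * f₂) ℤ.+ ℤ.- (+ 1 ℤ.* b) ℤ.* y)
                   (sumDivℤ≡F+rest r (2 + t)) (ℤP.pos-* r f₁) ⟩
        ((+ F r j ℤ.+ rest) ℤ.* + f₁ ℤ.+ ℤ.- a ℤ.* + r) ℤ.* + (2 * f₂) ℤ.+ ℤ.- (+ 1 ℤ.* b) ℤ.* (+ r ℤ.* + f₁)
          ≡⟨ solve (+ F r j) rest (+ f₁) a b (+ r) (+ (2 * f₂)) ⟩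
        (+ f₁ ℤ.* + F r j ℤ.- a ℤ.* + r ℤ.+ + f₁ ℤ.* rest) ℤ.* + (2 * f₂) ℤ.- b ℤ.* (+ r ℤ.* + f₁)
          ≡⟨ cong₃ (λ x y z → (x ℤ.- y ℤ.+ + f₁ ℤ.* rest) ℤ.* + (2 * f₂) ℤ.- b ℤ.* z)
                   (sym (ℤP.pos-* f₁ (F r j))) ar≡rʲ (sym (ℤP.pos-* r f₁)) ⟩
        N ∎

    ∣E∣≤ : ℤ.∣ E ∣ ≤ F-errorBound (2 + t) * r ^ (2 + t)
    ∣E∣≤ = ∣P-Q∣≤ (f₁ * F r j) (r ^ j) _ (r^k≤k!*F j r) ([1+k]!*F≤ (2 + t) r 1≤r)

    ∣rest∣≤ : ℤ.∣ rest ∣ ≤ (2 + t) * (B * r ^ (2 + t))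
    ∣rest∣≤ = ∣∑∣≤ (2 + t) (λ k → if does (2 + k ∣? j) then twistedTerm r j (2 + k) else + 0) (B * r ^ (2 + t)) (λ k _ → ∣[d∣j]twistedTerm∣≤ (2 + k) (s≤s (s≤s z≤n)))
      where
      ∣[d∣j]twistedTerm∣≤ : ∀ d → .{{_ : NonZero d}} → 2 ≤ d →
        ℤ.∣ (if does (d ∣? j) then twistedTerm r j d else + 0) ∣ ≤ B * r ^ (2 + t)
      ∣[d∣j]twistedTerm∣≤ d 2≤d with does (d ∣? j)
      ... | true  = ℕP.≤-trans (∣twistedTerm∣≤F r j d) (F[r/d,j/d]≤ r j d 1≤r (s≤s z≤n) 2≤d)
      ... | false = z≤n

    ∣N∣≤ : ℤ.∣ N ∣ ≤ K * r ^ (1 + t) * D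
    ∣N∣≤ = begin
      ℤ.∣ N ∣
        ≤⟨ ℤP.∣i-j∣≤∣i∣+∣j∣ ((E ℤ.+ + f₁ ℤ.* rest) ℤ.* + (2 * f₂)) (b ℤ.* + (r * f₁)) ⟩
      ℤ.∣ (E ℤ.+ + f₁ ℤ.* rest) ℤ.* + (2 * f₂) ∣ + ℤ.∣ b ℤ.* + (r * f₁) ∣
        ≡⟨ cong₂ _+_ (ℤP.abs-* (E ℤ.+ + f₁ ℤ.* rest) (+ (2 * f₂))) (ℤP.abs-* b (+ (r * f₁))) ⟩
      ℤ.∣ E ℤ.+ + f₁ ℤ.* rest ∣ * (2 * f₂) + 3 * x * (r * f₁)
        ≤⟨ ℕP.+-monoˡ-≤ (3 * x * (r * f₁)) (ℕP.*-monoˡ-≤ (2 * f₂) ∣E+f₁rest∣≤) ⟩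
      (Kᶠ * (r * x) + f₁ * ((2 + t) * (B * (r * x)))) * (2 * f₂) + 3 * x * (r * f₁)
        ≤⟨ ℕP.+-mono-≤ (ℕP.m≤m*n ((Kᶠ * (r * x) + f₁ * ((2 + t) * (B * (r * x)))) * (2 * f₂)) f₁) (ℕP.m≤m*n (3 * x * (r * f₁)) (2 * f₂)) ⟩
      (Kᶠ * (r * x) + f₁ * ((2 + t) * (B * (r * x)))) * (2 * f₂) * f₁ + 3 * x * (r * f₁) * (2 * f₂)
        ≡⟨ solve Kᶠ f₁ (2 + t) B f₂ x r ⟩
      K * x * D
        ∎
      where
      open ℕP.≤-Reasoning
      x : ℕ
      x = r ^ (1 + t)
      Kᶠ : ℕ
      Kᶠ = F-errorBound (2 + t)
      ∣E+f₁rest∣≤ : ℤ.∣ E ℤ.+ + f₁ ℤ.* rest ∣ ≤ Kᶠ * (r * x) + f₁ * ((2 + t) * (B * (r * x)))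
      ∣E+f₁rest∣≤ = ℕP.≤-trans (ℤP.∣i+j∣≤∣i∣+∣j∣ E (+ f₁ ℤ.* rest))
        (ℕP.+-mono-≤ ∣E∣≤ (ℕP.≤-trans (ℕP.≤-reflexive (ℤP.abs-* (+ f₁) rest)) (ℕP.*-monoʳ-≤ f₁ ∣rest∣≤)))
      solve : ∀ Kᶠ f₁ s B f₂ x r →
        (Kᶠ * (r * x) + f₁ * (s * (B * (r * x)))) * (2 * f₂) * f₁ + 3 * x * (r * f₁) * (2 * f₂)
          ≡ (Kᶠ + f₁ * s * B + 3) * x * (r * f₁ * (2 * f₂))
      solve = ℕSolver.solve-∀

    ∣deviation∣≤ : ℚ.∣ H r j ℚ.- (a ℚ./ f₁) ℚ.- (+ 1 ℚ./ 2) ℚ.* (b ℚ./ f₂) ∣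
                   ℚ.≤ (+ K ℚ./ 1) ℚ.* (+ (r ^ (1 + t)) ℚ./ 1)
    ∣deviation∣≤ = begin
      ℚ.∣ H r j ℚ.- (a ℚ./ f₁) ℚ.- (+ 1 ℚ./ 2) ℚ.* (b ℚ./ f₂) ∣  ≡⟨ cong ℚ.∣_∣ deviation≡N/D ⟩
      ℚ.∣ N ℚ./ D ∣                                            ≡⟨ ∣/∣ N D ⟩
      + ℤ.∣ N ∣ ℚ./ D                                          ≤⟨ /-≤ ℤ.∣ N ∣ (K * r ^ (1 + t)) D 1 (ℕP.≤-trans (ℕP.≤-reflexive (ℕP.*-identityʳ ℤ.∣ N ∣)) ∣N∣≤) ⟩
      + (K * r ^ (1 + t)) ℚ./ 1                                ≡⟨ cong (ℚ._/ 1) (ℤP.pos-* K (r ^ (1 + t))) ⟩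
      (+ K ℤ.* + (r ^ (1 + t))) ℚ./ 1                          ≡⟨ sym (/-*-/ (+ K) (+ (r ^ (1 + t))) 1 1) ⟩
      (+ K ℚ./ 1) ℚ.* (+ (r ^ (1 + t)) ℚ./ 1)                  ∎
      where open ℚP.≤-Reasoning

asymptotic : ∀ j → 3 ≤ j → ∃[ C ] ∃[ R ] ((r : ℕ) → .{{_ : NonZero r}} → R ≤ r →
  ℚ.∣ H r j ℚ.- (+ (r ^ (j ∸ 1)) ℚ./ (j !)) {{j ℕP.!≢0}}
            ℚ.- (+ 1 ℚ./ 2) ℚ.* (+ (3 * r ^ (j ∸ 2)) ℚ./ ((j ∸ 2) !)) {{(j ∸ 2) ℕP.!≢0}} ∣
    ℚ.≤ C ℚ.* (+ (r ^ (j ∸ 2)) ℚ./ 1))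
asymptotic (suc (suc (suc t))) (s≤s (s≤s (s≤s _))) = + Asymptotics.K t ℚ./ 1 , 1 , λ r 1≤r → Asymptotics.∣deviation∣≤ t r 1≤r

-- Imported only here: together with _∣_ in scope, ℚ's ∣_∣ makes expressions such as q ∣ e * p ambiguous.
open import Data.Rational using (∣_∣)

theorem6 :
  ((r : ℕ) → .{{_ : NonZero r}} →
      (r ≤ 2 → H r 0 ≡ 1ℚ)
    × (2 < r → H r 0 ≡ 0ℚ)
    × (H r 1 ≡ 1ℚ)
    × ((+ 2 ℚ./ 1) ℚ.* H r 2 ≡ (+ 3 ℤ.+ + r ℤ.- sgnχ2 r) ℚ./ 1)
    × ((+ 6 ℚ./ 1) ℚ.* H r 3
        ≡ (+ (8 ℕ.+ 9 ℕ.* r ℕ.+ r ^ 2) ℤ.- + 2 ℤ.* χ r 3) ℚ./ 1)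
    × ((+ 24 ℚ./ 1) ℚ.* H r 4
        ≡ (+ (42 ℕ.+ 59 ℕ.* r ℕ.+ 18 ℕ.* r ^ 2 ℕ.+ r ^ 3)
            ℤ.- + (18 ℕ.+ 3 ℕ.* r) ℤ.* sgnχ2 r) ℚ./ 1)
    × ((+ 120 ℚ./ 1) ℚ.* H r 5
        ≡ (+ (264 ℕ.+ 450 ℕ.* r ℕ.+ 215 ℕ.* r ^ 2 ℕ.+ 30 ℕ.* r ^ 3 ℕ.+ r ^ 4)
            ℤ.- + 24 ℤ.* χ r 5) ℚ./ 1)
    × ((j : ℕ) → 1 ≤ j → H r j ≡ generalRHS r j))
  × ((j : ℕ) → 3 ≤ j →
      ∃[ C ] ∃[ R ] ((r : ℕ) → .{{_ : NonZero r}} → R ≤ r →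
        ∣ H r j
          ℚ.- (+ (r ^ (j ∸ 1)) ℚ./ (j !)) {{j !≢0}}
          ℚ.- (+ 1 ℚ./ 2) ℚ.* (+ (3 ℕ.* r ^ (j ∸ 2)) ℚ./ ((j ∸ 2) !)) {{(j ∸ 2) !≢0}} ∣
        ℚ.≤ C ℚ.* (+ (r ^ (j ∸ 2)) ℚ./ 1)))
theorem6 =
  (λ r → H-0-≤2 r , H-0->2 r , H-1 r , H-2 r , H-3 r , H-4 r , H-5 r , general-formula r) , asymptotic
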